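{- Let $\mathcal{D}$ be the set of all Dyck paths. For $P\in\mathcal{D}$ let $|P|$ be its semilength, $\mathrm{sp}(P)$ and $\mathrm{ap}(P)$ its numbers of symmetric and asymmetric peaks, and $\mathrm{spw}(P)$ and $\mathrm{apw}(P)$ the sums of the weights of its symmetric peaks and of its asymmetric peaks, respectively. Then $$\sum_{P\in\mathcal{D}}t^{\mathrm{sp}(P)}r^{\mathrm{ap}(P)}w^{\mathrm{spw}(P)}y^{\mathrm{apw}(P)}z^{|P|} =\frac{1+z-\frac{twz(1+z)}{1-wz}+\frac{2ryz^2}{1-yz}-\sqrt{(1-z)\left[\left(1-\frac{twz}{1-wz}\right)^2-z\left(1-\frac{twz}{1-wz}+\frac{2ryz}{1-yz}\right)^2\right]}}{2z\left(1-\frac{twz}{1-wz}+\frac{ryz}{1-yz}\right)^2}.$$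
   Context: A Dyck path of semilength $n$ is a lattice path with steps $\mathbf{u}=(1,1)$ and $\mathbf{d}=(1,-1)$ from $(0,0)$ to $(2n,0)$ never going below the $x$-axis. A peak is an occurrence of consecutive steps $\mathbf{ud}$. Every peak extends to a unique maximal consecutive subsequence $\mathbf{u}^i\mathbf{d}^j$ ($i,j\ge 1$), its maximal mountain; the peak is symmetric if $i=j$ and asymmetric otherwise, and its weight is $\min\{i,j\}$. Thus $\mathrm{spw}(P)=\sum_{i\ge1} i\,\mathrm{sp}_i(P)$ and $\mathrm{apw}(P)=\sum_{i\ge1}i\,\mathrm{ap}_i(P)$, where $\mathrm{sp}_i,\mathrm{ap}_i$ count symmetric/asymmetric peaks of weight $i$. -}

module Defs where

open import Data.Nat as ℕ using (ℕ; zero; suc; _∸_; _≡ᵇ_; _⊔_; _⊓_)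
open import Data.Integer as ℤ using (ℤ; _+_; _*_; _-_; _^_; +_)
open import Data.Bool using (Bool; true; false; if_then_else_; not)
open import Data.List using (List; []; _∷_; map; _++_; filter; upTo; foldr; length)
open import Data.Product using (_×_; _,_)
open import Relation.Binary.PropositionalEquality using (_≡_)

data Step : Set where
  u d : Step

words : ℕ → List (List Step)
words zero    = [] ∷ []
words (suc k) = map (u ∷_) (words k) ++ map (d ∷_) (words k)

dyckFrom : ℕ → List Step → Bool
dyckFrom h       []       = h ≡ᵇ 0
dyckFrom h       (u ∷ xs) = dyckFrom (suc h) xs
dyckFrom zero    (d ∷ xs) = false
dyckFrom (suc h) (d ∷ xs) = dyckFrom h xs

isDyck : List Step → Bool
isDyck = dyckFrom 0

dyckPaths : ℕ → List (List Step)
dyckPaths n = filter (λ P → Data.Bool._≟_ (isDyck P) true) (words (n ℕ.+ n))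

sameStep : Step → Step → Bool
sameStep u u = true
sameStep d d = true
sameStep _ _ = false

runs : List Step → List (Step × ℕ)
runs [] = []
runs (s ∷ xs) with runs xs
... | [] = (s , 1) ∷ []
... | (s' , k) ∷ rest =
  if sameStep s s' then (s , suc k) ∷ rest else (s , 1) ∷ (s' , k) ∷ rest

-- each peak ud lies in a maximal mountain u^i d^j, i.e. a u-run of
-- length i immediately followed by a d-run of length j; return (i , j)
mountains : List (Step × ℕ) → List (ℕ × ℕ)
mountains ((u , i) ∷ (d , j) ∷ rest) = (i , j) ∷ mountains ((d , j) ∷ rest)
mountains (_ ∷ rest) = mountains rest
mountains [] = []

peaks : List Step → List (ℕ × ℕ)
peaks P = mountains (runs P)

isSym : ℕ × ℕ → Bool
isSym (i , j) = i ≡ᵇ j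

weight : ℕ × ℕ → ℕ
weight (i , j) = i ⊓ j

count : (ℕ × ℕ → Bool) → List (ℕ × ℕ) → ℕ
count p = foldr (λ x acc → if p x then suc acc else acc) 0

sumW : (ℕ × ℕ → Bool) → List (ℕ × ℕ) → ℕ
sumW p = foldr (λ x acc → if p x then weight x ℕ.+ acc else acc) 0

sp ap spw apw : List Step → ℕ
sp  P = count isSym (peaks P)
ap  P = count (λ x → not (isSym x)) (peaks P)
spw P = sumW isSym (peaks P)
apw P = sumW (λ x → not (isSym x)) (peaks P)

Series : Set
Series = ℕ → ℤ

infix 4 _≈_
_≈_ : Series → Series → Set
f ≈ g = ∀ n → f n ≡ g n

sumℤ : List ℤ → ℤ
sumℤ = foldr _+_ (+ 0)

_⊕_ _⊖_ _⊛_ : Series → Series → Series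
(f ⊕ g) n = f n + g n
(f ⊖ g) n = f n - g n
(f ⊛ g) n = sumℤ (map (λ k → f k * g (n ∸ k)) (upTo (suc n)))

infixl 6 _⊕_ _⊖_
infixl 7 _⊛_

const : ℤ → Series
const a zero    = a
const a (suc n) = + 0

Z : Series
Z 1 = + 1
Z _ = + 0

geom : ℤ → Series     -- 1 / (1 - a z) = Σ a^k z^k
geom a n = a ^ n

F : ℤ → ℤ → ℤ → ℤ → Series
F t r w y n =
  sumℤ (map (λ P → t ^ sp P * r ^ ap P * w ^ spw P * y ^ apw P) (dyckPaths n))

A B : ℤ → ℤ → ℤ → ℤ → Series
A t r w y = const (t * w) ⊛ Z ⊛ geom w
B t r w y = const (r * y) ⊛ Z ⊛ geom y

one two : Series
one = const (+ 1)
two = const (+ 2)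

Num : ℤ → ℤ → ℤ → ℤ → Series
Num t r w y = one ⊕ Z ⊖ (one ⊕ Z) ⊛ A t r w y ⊕ two ⊛ Z ⊛ B t r w y

Rad : ℤ → ℤ → ℤ → ℤ → Series
Rad t r w y =
  (one ⊖ Z) ⊛ ((one ⊖ A t r w y) ⊛ (one ⊖ A t r w y)
     ⊖ Z ⊛ ((one ⊖ A t r w y ⊕ two ⊛ B t r w y) ⊛ (one ⊖ A t r w y ⊕ two ⊛ B t r w y)))

Den : ℤ → ℤ → ℤ → ℤ → Series
Den t r w y = two ⊛ Z ⊛ ((one ⊖ A t r w y ⊕ B t r w y) ⊛ (one ⊖ A t r w y ⊕ B t r w y))

-- Let P be the generating function of the prime paths u p d and G that of the paths p d,
-- whose last descent is one step too long. Splitting a path at its first return to the axis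
-- leaves every peak intact, except that lengthening the ascent or the descent of a pyramid
-- u^k d^k makes its symmetric peak asymmetric of the same weight (and conversely). With
-- A = Σ t w^k z^k and B = Σ r y^k z^k accounting for these corrections one gets
--   F = 1 + P F,   G = 1 − A + B + P G,   P = A + z (P − A + B) G − z B.
-- Eliminating P and G leaves a quadratic equation for F, and S = Num − Den F is the square
-- root of its discriminant Rad.

module Submission where

open import Defs
open import Algebra.Bundles using (CommutativeRing; RawRing)
open import Algebra.Solver.Ring.AlmostCommutativeRing
  using (AlmostCommutativeRing; _-Raw-AlmostCommutative⟶_)
open import Algebra.Structures using (IsCommutativeSemiring)
open import Data.Bool using (Bool; true; false; if_then_else_; not; T; _≟_)
open import Data.Empty using (⊥; ⊥-elim)
open import Data.Integer as ℤ using (ℤ; _+_; _*_; _-_; +_; -_; _^_)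
import Data.Integer.Properties as ℤP
open import Data.Integer.Tactic.RingSolver using (solve-∀)
open import Data.List using (List; []; _∷_; map; _++_; filter; length; replicate; null; applyUpTo)
import Data.List.Properties as LP
open import Data.Maybe using (Maybe; just; nothing)
open import Data.Nat as ℕ using (ℕ; zero; suc; _∸_; _<_; _≤_; s≤s; z≤n; _⊓_; _≡ᵇ_)
import Data.Nat.Properties as ℕP
open import Data.Product as Product using (Σ; _×_; _,_; proj₁; proj₂)
open import Data.Unit using (⊤; tt)
open import Function using (_∘_; id)
open import Relation.Binary.PropositionalEquality
open import Relation.Nullary using (yes; no)

-- Finite sums

Σ< : ℕ → (ℕ → ℤ) → ℤ
Σ< zero    g = + 0
Σ< (suc m) g = g 0 + Σ< m (g ∘ suc)

Σ<-cong : ∀ m {f g : ℕ → ℤ} → (∀ k → k < m → f k ≡ g k) → Σ< m f ≡ Σ< m g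
Σ<-cong zero    f≡g = refl
Σ<-cong (suc m) f≡g =
  cong₂ _+_ (f≡g 0 (s≤s z≤n)) (Σ<-cong m (λ k k<m → f≡g (suc k) (s≤s k<m)))

Σ<-cong′ : ∀ m {f g : ℕ → ℤ} → (∀ k → f k ≡ g k) → Σ< m f ≡ Σ< m g
Σ<-cong′ m f≡g = Σ<-cong m (λ k _ → f≡g k)

Σ<-zero : ∀ m → Σ< m (λ _ → + 0) ≡ + 0
Σ<-zero zero    = refl
Σ<-zero (suc m) = cong (_+_ (+ 0)) (Σ<-zero m)

Σ<-+ : ∀ m (f g : ℕ → ℤ) → Σ< m (λ k → f k + g k) ≡ Σ< m f + Σ< m g
Σ<-+ zero    f g = refl
Σ<-+ (suc m) f g = begin
  f 0 + g 0 + Σ< m (λ k → f (suc k) + g (suc k))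
    ≡⟨ cong (_+_ (f 0 + g 0)) (Σ<-+ m (f ∘ suc) (g ∘ suc)) ⟩
  f 0 + g 0 + (Σ< m (f ∘ suc) + Σ< m (g ∘ suc))
    ≡⟨ interchange (f 0) (g 0) _ _ ⟩
  f 0 + Σ< m (f ∘ suc) + (g 0 + Σ< m (g ∘ suc)) ∎
  where
  open ≡-Reasoning
  interchange : ∀ a b c d → a + b + (c + d) ≡ a + c + (b + d)
  interchange = solve-∀

Σ<-*ˡ : ∀ m c (f : ℕ → ℤ) → Σ< m (λ k → c * f k) ≡ c * Σ< m f
Σ<-*ˡ zero    c f = sym (ℤP.*-zeroʳ c)
Σ<-*ˡ (suc m) c f =
  trans (cong (_+_ (c * f 0)) (Σ<-*ˡ m c (f ∘ suc))) (sym (ℤP.*-distribˡ-+ c (f 0) _))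

Σ<-neg : ∀ m (f : ℕ → ℤ) → Σ< m (λ k → - f k) ≡ - Σ< m f
Σ<-neg zero    f = refl
Σ<-neg (suc m) f =
  trans (cong (_+_ (- f 0)) (Σ<-neg m (f ∘ suc))) (sym (ℤP.neg-distrib-+ (f 0) _))

Σ<-snoc : ∀ m (g : ℕ → ℤ) → Σ< (suc m) g ≡ Σ< m g + g m
Σ<-snoc zero    g = trans (ℤP.+-identityʳ (g 0)) (sym (ℤP.+-identityˡ (g 0)))
Σ<-snoc (suc m) g =
  trans (cong (_+_ (g 0)) (Σ<-snoc m (g ∘ suc))) (sym (ℤP.+-assoc (g 0) _ _))

Σ<-reverse : ∀ n (g : ℕ → ℤ) → Σ< (suc n) g ≡ Σ< (suc n) (λ k → g (n ∸ k))
Σ<-reverse zero    g = refl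
Σ<-reverse (suc n) g = begin
  g 0 + Σ< (suc n) (g ∘ suc)
    ≡⟨ cong (_+_ (g 0)) (Σ<-reverse n (g ∘ suc)) ⟩
  g 0 + Σ< (suc n) (λ k → g (suc (n ∸ k)))
    ≡⟨ ℤP.+-comm (g 0) _ ⟩
  Σ< (suc n) (λ k → g (suc (n ∸ k))) + g 0
    ≡⟨ cong₂ _+_ (Σ<-cong (suc n) (λ k k≤n → cong g (sym (ℕP.+-∸-assoc 1 (ℕP.≤-pred k≤n)))))
                 (cong g (sym (ℕP.n∸n≡0 (suc n)))) ⟩
  Σ< (suc n) (λ k → g (suc n ∸ k)) + g (suc n ∸ suc n)
    ≡⟨ sym (Σ<-snoc (suc n) (λ k → g (suc n ∸ k))) ⟩
  Σ< (suc (suc n)) (λ k → g (suc n ∸ k)) ∎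
  where open ≡-Reasoning

Σ<-last : ∀ n (K : ℕ → ℤ) → Σ< (suc n) (λ i → if (n ∸ i) ≡ᵇ 0 then K i else + 0) ≡ K n
Σ<-last n K = begin
  Σ< (suc n) (λ i → if (n ∸ i) ≡ᵇ 0 then K i else + 0)
    ≡⟨ Σ<-snoc n _ ⟩
  Σ< n (λ i → if (n ∸ i) ≡ᵇ 0 then K i else + 0) + (if (n ∸ n) ≡ᵇ 0 then K n else + 0)
    ≡⟨ cong₂ _+_ (trans (Σ<-cong n earlier-vanish) (Σ<-zero n))
                 (cong (λ m → if m ≡ᵇ 0 then K n else + 0) (ℕP.n∸n≡0 n)) ⟩
  + 0 + K n
    ≡⟨ ℤP.+-identityˡ (K n) ⟩
  K n ∎
  where
  open ≡-Reasoning
  earlier-vanish : ∀ i → i < n → (if (n ∸ i) ≡ᵇ 0 then K i else + 0) ≡ + 0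
  earlier-vanish i i<n with n ∸ i | ℕP.m<n⇒0<n∸m i<n
  ... | suc _ | _ = refl

double : ℕ → ℕ
double zero    = 0
double (suc n) = suc (suc (double n))

double≡+ : ∀ n → double n ≡ n ℕ.+ n
double≡+ zero    = refl
double≡+ (suc n) = cong suc (trans (cong suc (double≡+ n)) (sym (ℕP.+-suc n n)))

Σ<-evens : ∀ n (h : ℕ → ℤ) → (∀ i → h (suc (double i)) ≡ + 0) →
           Σ< (suc (double n)) h ≡ Σ< (suc n) (h ∘ double)
Σ<-evens zero    h odd≡0 = refl
Σ<-evens (suc n) h odd≡0 = cong (_+_ (h 0)) (begin
  h 1 + Σ< (suc (double n)) (h ∘ suc ∘ suc)
    ≡⟨ cong (_+ Σ< (suc (double n)) (h ∘ suc ∘ suc)) (odd≡0 0) ⟩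
  + 0 + Σ< (suc (double n)) (h ∘ suc ∘ suc)
    ≡⟨ ℤP.+-identityˡ _ ⟩
  Σ< (suc (double n)) (h ∘ suc ∘ suc)
    ≡⟨ Σ<-evens n (h ∘ suc ∘ suc) (odd≡0 ∘ suc) ⟩
  Σ< (suc n) (h ∘ double ∘ suc) ∎)
  where open ≡-Reasoning

-- The ring of formal power series

⊛-as-Σ< : ∀ (f g : Series) n → (f ⊛ g) n ≡ Σ< (suc n) (λ k → f k * g (n ∸ k))
⊛-as-Σ< f g n = sumℤ-applyUpTo (suc n) id
  where
  sumℤ-applyUpTo : ∀ m (i : ℕ → ℕ) →
    sumℤ (map (λ k → f k * g (n ∸ k)) (applyUpTo i m)) ≡ Σ< m (λ k → f (i k) * g (n ∸ i k))
  sumℤ-applyUpTo zero    i = refl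
  sumℤ-applyUpTo (suc m) i = cong (_+_ (f (i 0) * g (n ∸ i 0))) (sumℤ-applyUpTo m (i ∘ suc))

0ₛ : Series
0ₛ _ = + 0

-ₛ_ : Series → Series
(-ₛ f) n = - f n

≈-refl : ∀ {f} → f ≈ f
≈-refl n = refl

≈-sym : ∀ {f g} → f ≈ g → g ≈ f
≈-sym f≈g n = sym (f≈g n)

≈-trans : ∀ {f g h} → f ≈ g → g ≈ h → f ≈ h
≈-trans f≈g g≈h n = trans (f≈g n) (g≈h n)

⊕-cong : ∀ {f f′ g g′} → f ≈ f′ → g ≈ g′ → f ⊕ g ≈ f′ ⊕ g′
⊕-cong f≈f′ g≈g′ n = cong₂ _+_ (f≈f′ n) (g≈g′ n)

⊖-cong : ∀ {f f′ g g′} → f ≈ f′ → g ≈ g′ → f ⊖ g ≈ f′ ⊖ g′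
⊖-cong f≈f′ g≈g′ n = cong₂ _-_ (f≈f′ n) (g≈g′ n)

⊛-cong : ∀ {f f′ g g′} → f ≈ f′ → g ≈ g′ → f ⊛ g ≈ f′ ⊛ g′
⊛-cong {f} {f′} {g} {g′} f≈f′ g≈g′ n = begin
  (f ⊛ g) n                              ≡⟨ ⊛-as-Σ< f g n ⟩
  Σ< (suc n) (λ k → f k * g (n ∸ k))     ≡⟨ Σ<-cong′ (suc n) (λ k → cong₂ _*_ (f≈f′ k) (g≈g′ (n ∸ k))) ⟩
  Σ< (suc n) (λ k → f′ k * g′ (n ∸ k))   ≡⟨ sym (⊛-as-Σ< f′ g′ n) ⟩
  (f′ ⊛ g′) n                            ∎
  where open ≡-Reasoning

⊛-comm : ∀ f g → f ⊛ g ≈ g ⊛ f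
⊛-comm f g n = begin
  (f ⊛ g) n                                            ≡⟨ ⊛-as-Σ< f g n ⟩
  Σ< (suc n) (λ k → f k * g (n ∸ k))                   ≡⟨ Σ<-reverse n (λ k → f k * g (n ∸ k)) ⟩
  Σ< (suc n) (λ k → f (n ∸ k) * g (n ∸ (n ∸ k)))       ≡⟨ Σ<-cong (suc n) swap ⟩
  Σ< (suc n) (λ k → g k * f (n ∸ k))                   ≡⟨ sym (⊛-as-Σ< g f n) ⟩
  (g ⊛ f) n                                            ∎
  where
  open ≡-Reasoning
  swap : ∀ k → k < suc n → f (n ∸ k) * g (n ∸ (n ∸ k)) ≡ g k * f (n ∸ k)
  swap k k≤n = trans (ℤP.*-comm (f (n ∸ k)) _) (cong (λ j → g j * f (n ∸ k)) (ℕP.m∸[m∸n]≡n (ℕP.≤-pred k≤n)))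

private
  conv : Series → Series → ℕ → ℤ
  conv f g n = Σ< (suc n) (λ k → f k * g (n ∸ k))

  conv-assoc : ∀ n (f g h : Series) →
    Σ< (suc n) (λ k → conv f g k * h (n ∸ k)) ≡ Σ< (suc n) (λ k → f k * conv g h (n ∸ k))
  conv-assoc zero f g h = ring (f 0) (g 0) (h 0)
    where
    ring : ∀ a b c → (a * b + + 0) * c + + 0 ≡ a * (b * c + + 0) + + 0
    ring = solve-∀
  conv-assoc (suc n) f g h = begin
    conv f g 0 * h (suc n) + Σ< (suc n) (λ k → conv f g (suc k) * h (n ∸ k))
      ≡⟨ cong (_+_ (conv f g 0 * h (suc n))) (Σ<-cong′ (suc n) (λ k →
           ℤP.*-distribʳ-+ (h (n ∸ k)) (f 0 * g (suc k)) (conv (f ∘ suc) g k))) ⟩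
    conv f g 0 * h (suc n) + Σ< (suc n) (λ k → f 0 * g (suc k) * h (n ∸ k) + conv (f ∘ suc) g k * h (n ∸ k))
      ≡⟨ cong (_+_ (conv f g 0 * h (suc n)))
           (Σ<-+ (suc n) (λ k → f 0 * g (suc k) * h (n ∸ k)) (λ k → conv (f ∘ suc) g k * h (n ∸ k))) ⟩
    conv f g 0 * h (suc n) + (Σ< (suc n) (λ k → f 0 * g (suc k) * h (n ∸ k))
                              + Σ< (suc n) (λ k → conv (f ∘ suc) g k * h (n ∸ k)))
      ≡⟨ cong₂ (λ a b → conv f g 0 * h (suc n) + (a + b))
           (trans (Σ<-cong′ (suc n) (λ k → ℤP.*-assoc (f 0) (g (suc k)) (h (n ∸ k))))
                  (Σ<-*ˡ (suc n) (f 0) (λ k → g (suc k) * h (n ∸ k))))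
           (conv-assoc n (f ∘ suc) g h) ⟩
    conv f g 0 * h (suc n) + (f 0 * Σ< (suc n) (λ k → g (suc k) * h (n ∸ k))
                              + Σ< (suc n) (λ k → f (suc k) * conv g h (n ∸ k)))
      ≡⟨ ring (f 0) (g 0) (h (suc n)) _ _ ⟩
    f 0 * conv g h (suc n) + Σ< (suc n) (λ k → f (suc k) * conv g h (n ∸ k)) ∎
    where
    open ≡-Reasoning
    ring : ∀ a b c d e → (a * b + + 0) * c + (a * d + e) ≡ a * (b * c + d) + e
    ring = solve-∀

⊛-assoc : ∀ f g h → (f ⊛ g) ⊛ h ≈ f ⊛ (g ⊛ h)
⊛-assoc f g h n = begin
  ((f ⊛ g) ⊛ h) n                             ≡⟨ ⊛-as-Σ< (f ⊛ g) h n ⟩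
  Σ< (suc n) (λ k → (f ⊛ g) k * h (n ∸ k))    ≡⟨ Σ<-cong′ (suc n) (λ k → cong (_* h (n ∸ k)) (⊛-as-Σ< f g k)) ⟩
  Σ< (suc n) (λ k → conv f g k * h (n ∸ k))   ≡⟨ conv-assoc n f g h ⟩
  Σ< (suc n) (λ k → f k * conv g h (n ∸ k))   ≡⟨ Σ<-cong′ (suc n) (λ k → cong (f k *_) (sym (⊛-as-Σ< g h (n ∸ k)))) ⟩
  Σ< (suc n) (λ k → f k * (g ⊛ h) (n ∸ k))    ≡⟨ sym (⊛-as-Σ< f (g ⊛ h) n) ⟩
  (f ⊛ (g ⊛ h)) n                             ∎
  where open ≡-Reasoning

const-⊛ : ∀ c f n → (const c ⊛ f) n ≡ c * f n
const-⊛ c f n = begin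
  (const c ⊛ f) n                           ≡⟨ ⊛-as-Σ< (const c) f n ⟩
  c * f n + Σ< n (λ k → + 0 * f (n ∸ suc k)) ≡⟨ cong (_+_ (c * f n)) (Σ<-zero n) ⟩
  c * f n + + 0                             ≡⟨ ℤP.+-identityʳ (c * f n) ⟩
  c * f n                                   ∎
  where open ≡-Reasoning

Z-⊛ : ∀ f n → (Z ⊛ f) (suc n) ≡ f n
Z-⊛ f n = begin
  (Z ⊛ f) (suc n)                         ≡⟨ ⊛-as-Σ< Z f (suc n) ⟩
  + 0 + (+ 1 * f n + Σ< n (λ _ → + 0))    ≡⟨ ℤP.+-identityˡ _ ⟩
  + 1 * f n + Σ< n (λ _ → + 0)            ≡⟨ cong₂ _+_ (ℤP.*-identityˡ (f n)) (Σ<-zero n) ⟩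
  f n + + 0                               ≡⟨ ℤP.+-identityʳ (f n) ⟩
  f n                                     ∎
  where open ≡-Reasoning

⊛-suc : ∀ f g n → f 0 ≡ + 0 → (f ⊛ g) (suc n) ≡ Σ< (suc n) (λ i → f (suc i) * g (n ∸ i))
⊛-suc f g n f₀≡0 = begin
  (f ⊛ g) (suc n)                                             ≡⟨ ⊛-as-Σ< f g (suc n) ⟩
  f 0 * g (suc n) + Σ< (suc n) (λ i → f (suc i) * g (n ∸ i))  ≡⟨ cong (λ a → a * g (suc n) + Σ< (suc n) (λ i → f (suc i) * g (n ∸ i))) f₀≡0 ⟩
  + 0 + Σ< (suc n) (λ i → f (suc i) * g (n ∸ i))              ≡⟨ ℤP.+-identityˡ _ ⟩
  Σ< (suc n) (λ i → f (suc i) * g (n ∸ i))                    ∎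
  where open ≡-Reasoning

⊛-distribˡ : ∀ f g h → f ⊛ (g ⊕ h) ≈ f ⊛ g ⊕ f ⊛ h
⊛-distribˡ f g h n = begin
  (f ⊛ (g ⊕ h)) n                                      ≡⟨ ⊛-as-Σ< f (g ⊕ h) n ⟩
  Σ< (suc n) (λ k → f k * (g (n ∸ k) + h (n ∸ k)))     ≡⟨ Σ<-cong′ (suc n) (λ k → ℤP.*-distribˡ-+ (f k) (g (n ∸ k)) (h (n ∸ k))) ⟩
  Σ< (suc n) (λ k → f k * g (n ∸ k) + f k * h (n ∸ k)) ≡⟨ Σ<-+ (suc n) (λ k → f k * g (n ∸ k)) (λ k → f k * h (n ∸ k)) ⟩
  conv f g n + conv f h n                              ≡⟨ sym (cong₂ _+_ (⊛-as-Σ< f g n) (⊛-as-Σ< f h n)) ⟩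
  (f ⊛ g ⊕ f ⊛ h) n                                    ∎
  where open ≡-Reasoning

-ₛ-⊛ : ∀ f g → (-ₛ f) ⊛ g ≈ -ₛ (f ⊛ g)
-ₛ-⊛ f g n = begin
  ((-ₛ f) ⊛ g) n                          ≡⟨ ⊛-as-Σ< (-ₛ f) g n ⟩
  Σ< (suc n) (λ k → - f k * g (n ∸ k))    ≡⟨ Σ<-cong′ (suc n) (λ k → sym (ℤP.neg-distribˡ-* (f k) (g (n ∸ k)))) ⟩
  Σ< (suc n) (λ k → - (f k * g (n ∸ k)))  ≡⟨ Σ<-neg (suc n) (λ k → f k * g (n ∸ k)) ⟩
  - conv f g n                            ≡⟨ cong -_ (sym (⊛-as-Σ< f g n)) ⟩
  (-ₛ (f ⊛ g)) n                          ∎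
  where open ≡-Reasoning

⊛-identityˡ : ∀ f → one ⊛ f ≈ f
⊛-identityˡ f n = trans (const-⊛ (+ 1) f n) (ℤP.*-identityˡ (f n))

⊛-zeroˡ : ∀ f → 0ₛ ⊛ f ≈ 0ₛ
⊛-zeroˡ f n = trans (⊛-as-Σ< 0ₛ f n) (Σ<-zero (suc n))

⊛-isCommutativeSemiring : IsCommutativeSemiring _≈_ _⊕_ _⊛_ 0ₛ one
⊛-isCommutativeSemiring = record
  { isSemiring = record
    { isSemiringWithoutAnnihilatingZero = record
      { +-isCommutativeMonoid = record
        { isMonoid = record
          { isSemigroup = record
            { isMagma = record
              { isEquivalence = record { refl = ≈-refl ; sym = ≈-sym ; trans = ≈-trans }
              ; ∙-cong = ⊕-cong }
            ; assoc = λ f g h n → ℤP.+-assoc (f n) (g n) (h n) }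
          ; identity = (λ f n → ℤP.+-identityˡ (f n)) , (λ f n → ℤP.+-identityʳ (f n)) }
        ; comm = λ f g n → ℤP.+-comm (f n) (g n) }
      ; *-cong = ⊛-cong
      ; *-assoc = ⊛-assoc
      ; *-identity = ⊛-identityˡ , (λ f → ≈-trans (⊛-comm f one) (⊛-identityˡ f))
      ; distrib = ⊛-distribˡ , (λ f g h → ≈-trans (⊛-comm (g ⊕ h) f)
                                (≈-trans (⊛-distribˡ f g h) (⊕-cong (⊛-comm f g) (⊛-comm f h)))) }
    ; zero = ⊛-zeroˡ , (λ f → ≈-trans (⊛-comm f 0ₛ) (⊛-zeroˡ f)) }
  ; *-comm = ⊛-comm }

seriesRing : AlmostCommutativeRing _ _
seriesRing = record
  { Carrier = Series
  ; _≈_ = _≈_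
  ; _+_ = _⊕_
  ; _*_ = _⊛_
  ; -_ = -ₛ_
  ; 0# = 0ₛ
  ; 1# = one
  ; isAlmostCommutativeRing = record
    { isCommutativeSemiring = ⊛-isCommutativeSemiring
    ; -‿cong = λ f≈g n → cong -_ (f≈g n)
    ; -‿*-distribˡ = -ₛ-⊛
    ; -‿+-comm = λ f g n → sym (ℤP.neg-distrib-+ (f n) (g n)) } }

private
  ℤ-rawRing : RawRing _ _
  ℤ-rawRing = CommutativeRing.rawRing ℤP.+-*-commutativeRing

const-homomorphism : ℤ-rawRing -Raw-AlmostCommutative⟶ seriesRing
const-homomorphism = record
  { ⟦_⟧ = const
  ; +-homo = λ a b → λ { zero → refl ; (suc n) → refl }
  ; *-homo = λ a b n → sym (trans (const-⊛ a (const b) n) (const-* a b n))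
  ; -‿homo = λ a → λ { zero → refl ; (suc n) → refl }
  ; 0-homo = λ { zero → refl ; (suc n) → refl }
  ; 1-homo = λ { zero → refl ; (suc n) → refl } }
  where
  const-* : ∀ a b n → a * const b n ≡ const (a * b) n
  const-* a b zero    = refl
  const-* a b (suc n) = ℤP.*-zeroʳ a

const-≟ : ∀ a b → Maybe (const a ≈ const b)
const-≟ a b with a ℤ.≟ b
... | yes a≡b = just (λ n → cong (λ c → const c n) a≡b)
... | no  _   = nothing

open import Algebra.Solver.Ring ℤ-rawRing seriesRing const-homomorphism const-≟
  using (solve; con; _:+_; _:-_; _:*_; _:=_)

-- Sums over Dyck words

sumℤ-map-++ : ∀ {X : Set} (f : X → ℤ) xs ys →
  sumℤ (map f (xs ++ ys)) ≡ sumℤ (map f xs) + sumℤ (map f ys)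
sumℤ-map-++ f []       ys = sym (ℤP.+-identityˡ _)
sumℤ-map-++ f (x ∷ xs) ys = trans (cong (_+_ (f x)) (sumℤ-map-++ f xs ys)) (sym (ℤP.+-assoc (f x) _ _))

∑words : ℕ → (List Step → ℤ) → ℤ
∑words m f = sumℤ (map f (words m))

∑words-suc : ∀ m f → ∑words (suc m) f ≡ ∑words m (f ∘ (u ∷_)) + ∑words m (f ∘ (d ∷_))
∑words-suc m f = begin
  sumℤ (map f (map (u ∷_) (words m) ++ map (d ∷_) (words m)))
    ≡⟨ sumℤ-map-++ f (map (u ∷_) (words m)) (map (d ∷_) (words m)) ⟩
  sumℤ (map f (map (u ∷_) (words m))) + sumℤ (map f (map (d ∷_) (words m)))
    ≡⟨ sym (cong₂ _+_ (cong sumℤ (LP.map-∘ (words m))) (cong sumℤ (LP.map-∘ (words m)))) ⟩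
  ∑words m (f ∘ (u ∷_)) + ∑words m (f ∘ (d ∷_)) ∎
  where open ≡-Reasoning

∑words-cong : ∀ m {f g : List Step → ℤ} → (∀ v → length v ≡ m → f v ≡ g v) → ∑words m f ≡ ∑words m g
∑words-cong zero    f≡g = cong (_+ + 0) (f≡g [] refl)
∑words-cong (suc m) {f} {g} f≡g = begin
  ∑words (suc m) f                                 ≡⟨ ∑words-suc m f ⟩
  ∑words m (f ∘ (u ∷_)) + ∑words m (f ∘ (d ∷_))
    ≡⟨ cong₂ _+_ (∑words-cong m (λ v ∣v∣≡m → f≡g (u ∷ v) (cong suc ∣v∣≡m)))
                 (∑words-cong m (λ v ∣v∣≡m → f≡g (d ∷ v) (cong suc ∣v∣≡m))) ⟩
  ∑words m (g ∘ (u ∷_)) + ∑words m (g ∘ (d ∷_))    ≡⟨ sym (∑words-suc m g) ⟩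
  ∑words (suc m) g                                 ∎
  where open ≡-Reasoning

∑words-+ : ∀ m (f g : List Step → ℤ) → ∑words m (λ v → f v + g v) ≡ ∑words m f + ∑words m g
∑words-+ m f g = go (words m)
  where
  go : ∀ vs → sumℤ (map (λ v → f v + g v) vs) ≡ sumℤ (map f vs) + sumℤ (map g vs)
  go []       = refl
  go (v ∷ vs) = trans (cong (_+_ (f v + g v)) (go vs)) (interchange (f v) (g v) _ _)
    where
    interchange : ∀ a b c d → a + b + (c + d) ≡ a + c + (b + d)
    interchange = solve-∀

∑words-*ˡ : ∀ m c (f : List Step → ℤ) → ∑words m (λ v → c * f v) ≡ c * ∑words m f
∑words-*ˡ m c f = go (words m)
  where
  go : ∀ vs → sumℤ (map (λ v → c * f v) vs) ≡ c * sumℤ (map f vs)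
  go []       = sym (ℤP.*-zeroʳ c)
  go (v ∷ vs) = trans (cong (_+_ (c * f v)) (go vs)) (sym (ℤP.*-distribˡ-+ c (f v) _))

∑from : ℕ → ℕ → (List Step → ℤ) → ℤ
∑from h m f = ∑words m (λ v → if dyckFrom h v then f v else + 0)

∑from-cong : ∀ h m {f g : List Step → ℤ} →
  (∀ v → length v ≡ m → dyckFrom h v ≡ true → f v ≡ g v) → ∑from h m f ≡ ∑from h m g
∑from-cong h m {f} {g} f≡g = ∑words-cong m on-paths
  where
  on-paths : ∀ v → length v ≡ m →
    (if dyckFrom h v then f v else + 0) ≡ (if dyckFrom h v then g v else + 0)
  on-paths v ∣v∣≡m with dyckFrom h v in isPath
  ... | true  = f≡g v ∣v∣≡m isPath
  ... | false = refl

∑from-+ : ∀ h m (f g : List Step → ℤ) → ∑from h m (λ v → f v + g v) ≡ ∑from h m f + ∑from h m g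
∑from-+ h m f g = trans (∑words-cong m (λ v _ → if-+ (dyckFrom h v))) (∑words-+ m _ _)
  where
  if-+ : ∀ {v} b → (if b then f v + g v else + 0) ≡ (if b then f v else + 0) + (if b then g v else + 0)
  if-+ true  = refl
  if-+ false = refl

∑from-*ˡ : ∀ h m c (f : List Step → ℤ) → ∑from h m (λ v → c * f v) ≡ c * ∑from h m f
∑from-*ˡ h m c f = trans (∑words-cong m (λ v _ → if-* (dyckFrom h v))) (∑words-*ˡ m c _)
  where
  if-* : ∀ {v} b → (if b then c * f v else + 0) ≡ c * (if b then f v else + 0)
  if-* true  = refl
  if-* false = sym (ℤP.*-zeroʳ c)

∑from-*ʳ : ∀ h m c (f : List Step → ℤ) → ∑from h m (λ v → f v * c) ≡ ∑from h m f * c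
∑from-*ʳ h m c f =
  trans (∑from-cong h m (λ v _ _ → ℤP.*-comm (f v) c)) (trans (∑from-*ˡ h m c f) (ℤP.*-comm c _))

∑from-zero : ∀ h m {f : List Step → ℤ} → (∀ v → f v ≡ + 0) → ∑from h m f ≡ + 0
∑from-zero h m {f} f≡0 = begin
  ∑from h m f                    ≡⟨ ∑from-cong h m (λ v _ _ → trans (f≡0 v) (sym (ℤP.*-zeroˡ (f v)))) ⟩
  ∑from h m (λ v → + 0 * f v)    ≡⟨ ∑from-*ˡ h m (+ 0) f ⟩
  + 0 * ∑from h m f              ≡⟨ ℤP.*-zeroˡ (∑from h m f) ⟩
  + 0                            ∎
  where open ≡-Reasoning

∑from-ground : ∀ m f → ∑from 0 (suc m) f ≡ ∑from 1 m (f ∘ (u ∷_))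
∑from-ground m f = begin
  ∑from 0 (suc m) f                                   ≡⟨ ∑words-suc m _ ⟩
  ∑from 1 m (f ∘ (u ∷_)) + ∑words m (λ _ → + 0)       ≡⟨ cong (_+_ (∑from 1 m (f ∘ (u ∷_)))) no-descent ⟩
  ∑from 1 m (f ∘ (u ∷_)) + + 0                        ≡⟨ ℤP.+-identityʳ _ ⟩
  ∑from 1 m (f ∘ (u ∷_))                              ∎
  where
  open ≡-Reasoning
  no-descent : ∑words m (λ _ → + 0) ≡ + 0
  no-descent = trans (∑words-*ˡ m (+ 0) (λ _ → + 0)) (ℤP.*-zeroˡ (∑words m (λ _ → + 0)))

∑from-suc : ∀ h m f →
  ∑from (suc h) (suc m) f ≡ ∑from (suc (suc h)) m (f ∘ (u ∷_)) + ∑from h m (f ∘ (d ∷_))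
∑from-suc h m f = ∑words-suc m _

-- Splitting a path from height j + 1 + L at its first descent to height L.
∑from-first-passage : ∀ m j L (f : List Step → ℤ) →
  ∑from (j ℕ.+ suc L) m f ≡ Σ< m (λ k → ∑from j k (λ p → ∑from L (m ∸ suc k) (λ q → f (p ++ d ∷ q))))
∑from-first-passage zero j L f rewrite ℕP.+-suc j L = refl
∑from-first-passage (suc m) zero L f = begin
  ∑from (suc L) (suc m) f
    ≡⟨ ∑from-suc L m f ⟩
  ∑from (suc (suc L)) m (f ∘ (u ∷_)) + ∑from L m (f ∘ (d ∷_))
    ≡⟨ cong (_+ ∑from L m (f ∘ (d ∷_))) (∑from-first-passage m 1 L (f ∘ (u ∷_))) ⟩
  Σ< m (λ k → ∑from 1 k (λ p → rest k (u ∷ p))) + ∑from L m (f ∘ (d ∷_))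
    ≡⟨ ℤP.+-comm (Σ< m (λ k → ∑from 1 k (λ p → rest k (u ∷ p)))) (∑from L m (f ∘ (d ∷_))) ⟩
  ∑from L m (f ∘ (d ∷_)) + Σ< m (λ k → ∑from 1 k (λ p → rest k (u ∷ p)))
    ≡⟨ cong₂ _+_ (sym (ℤP.+-identityʳ (∑from L m (f ∘ (d ∷_))))) (Σ<-cong′ m (λ k → sym (∑from-ground k (rest k)))) ⟩
  Σ< (suc m) (λ k → ∑from 0 k (λ p → ∑from L (suc m ∸ suc k) (λ q → f (p ++ d ∷ q)))) ∎
  where
  open ≡-Reasoning
  rest : ℕ → List Step → ℤ
  rest k p = ∑from L (m ∸ suc k) (λ q → f (p ++ d ∷ q))
∑from-first-passage (suc m) (suc j) L f = begin
  ∑from (suc (j ℕ.+ suc L)) (suc m) f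
    ≡⟨ ∑from-suc (j ℕ.+ suc L) m f ⟩
  ∑from (suc (suc j) ℕ.+ suc L) m (f ∘ (u ∷_)) + ∑from (j ℕ.+ suc L) m (f ∘ (d ∷_))
    ≡⟨ cong₂ _+_ (∑from-first-passage m (suc (suc j)) L (f ∘ (u ∷_)))
                 (∑from-first-passage m j L (f ∘ (d ∷_))) ⟩
  Σ< m (λ k → ∑from (suc (suc j)) k (λ p → rest k (u ∷ p))) + Σ< m (λ k → ∑from j k (λ p → rest k (d ∷ p)))
    ≡⟨ sym (Σ<-+ m (λ k → ∑from (suc (suc j)) k (λ p → rest k (u ∷ p)))
                   (λ k → ∑from j k (λ p → rest k (d ∷ p)))) ⟩
  Σ< m (λ k → ∑from (suc (suc j)) k (λ p → rest k (u ∷ p)) + ∑from j k (λ p → rest k (d ∷ p)))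
    ≡⟨ Σ<-cong′ m (λ k → sym (∑from-suc j k (rest k))) ⟩
  Σ< m (λ k → ∑from (suc j) (suc k) (rest k))
    ≡⟨ sym (ℤP.+-identityˡ _) ⟩
  Σ< (suc m) (λ k → ∑from (suc j) k (λ p → ∑from L (suc m ∸ suc k) (λ q → f (p ++ d ∷ q)))) ∎
  where
  open ≡-Reasoning
  rest : ℕ → List Step → ℤ
  rest k p = ∑from L (m ∸ suc k) (λ q → f (p ++ d ∷ q))

∑from-first-return : ∀ m (f : List Step → ℤ) →
  ∑from 0 (suc m) f ≡ Σ< m (λ k → ∑from 0 k (λ p → ∑from 0 (m ∸ suc k) (λ q → f (u ∷ p ++ d ∷ q))))
∑from-first-return m f = trans (∑from-ground m f) (∑from-first-passage m 0 0 (f ∘ (u ∷_)))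

odd : ℕ → Bool
odd zero    = false
odd (suc n) = not (odd n)

∑from-odd : ∀ m h (f : List Step → ℤ) → odd (h ℕ.+ m) ≡ true → ∑from h m f ≡ + 0
∑from-odd zero    zero    f ()
∑from-odd zero    (suc h) f _ = refl
∑from-odd (suc m) zero    f odd-m = trans (∑from-ground m f) (∑from-odd m 1 _ odd-m)
∑from-odd (suc m) (suc h) f odd-h+m = trans (∑from-suc h m f)
  (cong₂ _+_ (∑from-odd m (suc (suc h)) _ (trans (not-not (odd (h ℕ.+ m))) odd-h+m′))
             (∑from-odd m h _ odd-h+m′))
  where
  not-not : ∀ b → not (not b) ≡ b
  not-not true  = refl
  not-not false = refl
  odd-h+m′ : odd (h ℕ.+ m) ≡ true
  odd-h+m′ = trans (sym (trans (cong (not ∘ odd) (ℕP.+-suc h m)) (not-not (odd (h ℕ.+ m))))) odd-h+m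

odd-double : ∀ i → odd (double i) ≡ false
odd-double zero    = refl
odd-double (suc i) = cong (not ∘ not) (odd-double i)

∑paths : ℕ → (List Step → ℤ) → ℤ
∑paths n = ∑from 0 (double n)

∑paths-first-return : ∀ n (f : List Step → ℤ) →
  ∑paths (suc n) f ≡ Σ< (suc n) (λ i → ∑paths i (λ p → ∑paths (n ∸ i) (λ q → f (u ∷ p ++ d ∷ q))))
∑paths-first-return n f = begin
  ∑paths (suc n) f
    ≡⟨ ∑from-first-return (suc (double n)) f ⟩
  Σ< (suc (double n)) (λ k → ∑from 0 k (λ p → ∑from 0 (double n ∸ k) (λ q → f (u ∷ p ++ d ∷ q))))
    ≡⟨ Σ<-evens n (λ k → ∑from 0 k (λ p → ∑from 0 (double n ∸ k) (λ q → f (u ∷ p ++ d ∷ q))))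
                 (λ i → ∑from-odd (suc (double i)) 0 _ (cong not (odd-double i))) ⟩
  Σ< (suc n) (λ i → ∑paths i (λ p → ∑from 0 (double n ∸ double i) (λ q → f (u ∷ p ++ d ∷ q))))
    ≡⟨ Σ<-cong′ (suc n) (λ i → cong (λ m → ∑paths i (λ p → ∑from 0 m (λ q → f (u ∷ p ++ d ∷ q))))
                                     (double-∸ n i)) ⟩
  Σ< (suc n) (λ i → ∑paths i (λ p → ∑paths (n ∸ i) (λ q → f (u ∷ p ++ d ∷ q)))) ∎
  where
  open ≡-Reasoning
  double-∸ : ∀ n i → double n ∸ double i ≡ double (n ∸ i)
  double-∸ n       zero    = refl
  double-∸ zero    (suc i) = refl
  double-∸ (suc n) (suc i) = double-∸ n i

-- Mountains

up down : ℕ → List Step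
up n   = replicate n u
down n = replicate n d

fromMountains : List (ℕ × ℕ) → List Step
fromMountains []             = []
fromMountains ((a , b) ∷ ms) = up (suc a) ++ down (suc b) ++ fromMountains ms

private
  runsOf : List (ℕ × ℕ) → List (Step × ℕ)
  runsOf []             = []
  runsOf ((a , b) ∷ ms) = (u , suc a) ∷ (d , suc b) ∷ runsOf ms

  StartsWithAscent : List (Step × ℕ) → Set
  StartsWithAscent []            = ⊤
  StartsWithAscent ((u , _) ∷ _) = ⊤
  StartsWithAscent ((d , _) ∷ _) = ⊥

  runs-down : ∀ b v X → runs v ≡ X → StartsWithAscent X → runs (down (suc b) ++ v) ≡ (d , suc b) ∷ X
  runs-down zero    v []            eq _ rewrite eq = refl
  runs-down zero    v ((u , _) ∷ X) eq _ rewrite eq = refl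
  runs-down (suc b) v X eq ascent rewrite runs-down b v X eq ascent = refl

  runs-up : ∀ a v k X → runs v ≡ (d , k) ∷ X → runs (up (suc a) ++ v) ≡ (u , suc a) ∷ (d , k) ∷ X
  runs-up zero    v k X eq rewrite eq = refl
  runs-up (suc a) v k X eq rewrite runs-up a v k X eq = refl

  runs-fromMountains : ∀ ms → runs (fromMountains ms) ≡ runsOf ms
  runs-fromMountains []             = refl
  runs-fromMountains ((a , b) ∷ ms) =
    runs-up a _ (suc b) (runsOf ms) (runs-down b _ (runsOf ms) (runs-fromMountains ms) (ascent ms))
    where
    ascent : ∀ ms → StartsWithAscent (runsOf ms)
    ascent []      = tt
    ascent (_ ∷ _) = tt

  mountains-runsOf : ∀ ms → mountains (runsOf ms) ≡ map (Product.map suc suc) ms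
  mountains-runsOf []             = refl
  mountains-runsOf ((a , b) ∷ ms) = cong ((suc a , suc b) ∷_) (mountains-runsOf ms)

peaks-fromMountains : ∀ ms → peaks (fromMountains ms) ≡ map (Product.map suc suc) ms
peaks-fromMountains ms = trans (cong mountains (runs-fromMountains ms)) (mountains-runsOf ms)

fromMountains-++ : ∀ ms ms′ → fromMountains (ms ++ ms′) ≡ fromMountains ms ++ fromMountains ms′
fromMountains-++ []             ms′ = refl
fromMountains-++ ((a , b) ∷ ms) ms′ = begin
  up (suc a) ++ down (suc b) ++ fromMountains (ms ++ ms′)
    ≡⟨ cong (λ v → up (suc a) ++ down (suc b) ++ v) (fromMountains-++ ms ms′) ⟩
  up (suc a) ++ down (suc b) ++ fromMountains ms ++ fromMountains ms′
    ≡⟨ cong (up (suc a) ++_) (sym (LP.++-assoc (down (suc b)) _ _)) ⟩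
  up (suc a) ++ (down (suc b) ++ fromMountains ms) ++ fromMountains ms′
    ≡⟨ sym (LP.++-assoc (up (suc a)) _ _) ⟩
  (up (suc a) ++ down (suc b) ++ fromMountains ms) ++ fromMountains ms′ ∎
  where open ≡-Reasoning

replicate-snoc : ∀ n (s : Step) → replicate n s ++ s ∷ [] ≡ s ∷ replicate n s
replicate-snoc zero    s = refl
replicate-snoc (suc n) s = cong (s ∷_) (replicate-snoc n s)

fromMountains-∷ʳ-d : ∀ ms c e →
  fromMountains (ms ++ (c , e) ∷ []) ++ d ∷ [] ≡ fromMountains (ms ++ (c , suc e) ∷ [])
fromMountains-∷ʳ-d [] c e = begin
  (up (suc c) ++ down (suc e) ++ []) ++ d ∷ []
    ≡⟨ LP.++-assoc (up (suc c)) _ (d ∷ []) ⟩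
  up (suc c) ++ (down (suc e) ++ []) ++ d ∷ []
    ≡⟨ cong (λ v → up (suc c) ++ v ++ d ∷ []) (LP.++-identityʳ (down (suc e))) ⟩
  up (suc c) ++ down (suc e) ++ d ∷ []
    ≡⟨ cong (λ v → up (suc c) ++ d ∷ v) (replicate-snoc e d) ⟩
  up (suc c) ++ down (suc (suc e))
    ≡⟨ cong (up (suc c) ++_) (sym (LP.++-identityʳ (down (suc (suc e))))) ⟩
  up (suc c) ++ down (suc (suc e)) ++ [] ∎
  where open ≡-Reasoning
fromMountains-∷ʳ-d ((a , b) ∷ ms) c e = begin
  (up (suc a) ++ down (suc b) ++ fromMountains (ms ++ (c , e) ∷ [])) ++ d ∷ []
    ≡⟨ LP.++-assoc (up (suc a)) _ (d ∷ []) ⟩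
  up (suc a) ++ (down (suc b) ++ fromMountains (ms ++ (c , e) ∷ [])) ++ d ∷ []
    ≡⟨ cong (up (suc a) ++_) (LP.++-assoc (down (suc b)) _ (d ∷ [])) ⟩
  up (suc a) ++ down (suc b) ++ fromMountains (ms ++ (c , e) ∷ []) ++ d ∷ []
    ≡⟨ cong (λ v → up (suc a) ++ down (suc b) ++ v) (fromMountains-∷ʳ-d ms c e) ⟩
  up (suc a) ++ down (suc b) ++ fromMountains (ms ++ (c , suc e) ∷ []) ∎
  where open ≡-Reasoning

null-fromMountains-∷ʳ : ∀ ms m → null (fromMountains (ms ++ m ∷ [])) ≡ false
null-fromMountains-∷ʳ []      _ = refl
null-fromMountains-∷ʳ (_ ∷ _) _ = refl

pyramid : ℕ → List Step
pyramid k = up k ++ down k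

lift : List Step → List Step
lift p = u ∷ p ++ d ∷ []

lift-pyramid : ∀ k → lift (pyramid k) ≡ pyramid (suc k)
lift-pyramid k = cong (u ∷_) (trans (LP.++-assoc (up k) (down k) (d ∷ [])) (cong (up k ++_) (replicate-snoc k d)))

lift-pyramid-mountain : ∀ k → lift (pyramid k) ≡ fromMountains ((k , k) ∷ [])
lift-pyramid-mountain k =
  trans (lift-pyramid k) (cong (up (suc k) ++_) (sym (LP.++-identityʳ (down (suc k)))))

-- Either lift p is a pyramid, or its first mountain climbs more than it descends and
-- its last mountain descends more than it climbs: then an extra u in front or an extra d
-- at the end leaves the symmetry and the weight of every peak unchanged.
data PrimeShape (p : List Step) : Set where
  pyramidal : ∀ k → p ≡ pyramid k → PrimeShape p
  skewed    : ∀ a b ms c e → lift p ≡ fromMountains ((a , b) ∷ ms ++ (c , e) ∷ []) →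
              b < a → c < e → PrimeShape p

data TailShape (q : List Step) : Set where
  empty    : q ≡ [] → TailShape q
  steepEnd : ∀ ms c e → q ≡ fromMountains (ms ++ (c , e) ∷ []) → c ≤ e → TailShape q

record FirstMountain (p : List Step) : Set where
  constructor firstMountain
  field
    ascent descent : ℕ
    others         : List (ℕ × ℕ)
    lift-p         : lift p ≡ fromMountains ((ascent , descent) ∷ others)
    descent≤ascent : descent ≤ ascent

firstMountainOf : ∀ {p} → PrimeShape p → FirstMountain p
firstMountainOf (pyramidal k refl)          = firstMountain k k [] (lift-pyramid-mountain k) ℕP.≤-refl
firstMountainOf (skewed a b ms c e eq b<a _) = firstMountain a b (ms ++ (c , e) ∷ []) eq (ℕP.<⇒≤ b<a)

shapes-first-return : ∀ p q → PrimeShape p → TailShape q →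
  PrimeShape (u ∷ p ++ d ∷ q) × TailShape (u ∷ p ++ d ∷ q)
shapes-first-return p q (pyramidal k refl) (empty refl) =
  pyramidal (suc k) (lift-pyramid k) , steepEnd [] k k (lift-pyramid-mountain k) ℕP.≤-refl
shapes-first-return p q (skewed a b ms c e eq b<a c<e) (empty refl) =
  skewed (suc a) b ms c (suc e)
    (cong (u ∷_) (trans (cong (_++ d ∷ []) eq) (fromMountains-∷ʳ-d ((a , b) ∷ ms) c e)))
    (ℕP.m<n⇒m<1+n b<a) (ℕP.m<n⇒m<1+n c<e)
  , steepEnd ((a , b) ∷ ms) c e eq (ℕP.<⇒≤ c<e)
shapes-first-return p q shape (steepEnd ms c e refl c≤e)
  with firstMountain a b others eq b≤a ← firstMountainOf shape =
  skewed (suc a) b (others ++ ms) c (suc e) lift-path (s≤s b≤a) (s≤s c≤e) ,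
  steepEnd ((a , b) ∷ others ++ ms) c e path c≤e
  where
  open ≡-Reasoning
  path : u ∷ p ++ d ∷ fromMountains (ms ++ (c , e) ∷ [])
       ≡ fromMountains (((a , b) ∷ others ++ ms) ++ (c , e) ∷ [])
  path = begin
    u ∷ p ++ d ∷ fromMountains (ms ++ (c , e) ∷ [])
      ≡⟨ cong (u ∷_) (sym (LP.++-assoc p (d ∷ []) _)) ⟩
    lift p ++ fromMountains (ms ++ (c , e) ∷ [])
      ≡⟨ cong (_++ fromMountains (ms ++ (c , e) ∷ [])) eq ⟩
    fromMountains ((a , b) ∷ others) ++ fromMountains (ms ++ (c , e) ∷ [])
      ≡⟨ sym (fromMountains-++ ((a , b) ∷ others) (ms ++ (c , e) ∷ [])) ⟩
    fromMountains ((a , b) ∷ others ++ ms ++ (c , e) ∷ [])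
      ≡⟨ cong (λ ms′ → fromMountains ((a , b) ∷ ms′)) (sym (LP.++-assoc others ms _)) ⟩
    fromMountains (((a , b) ∷ others ++ ms) ++ (c , e) ∷ []) ∎
  lift-path : lift (u ∷ p ++ d ∷ fromMountains (ms ++ (c , e) ∷ []))
            ≡ fromMountains ((suc a , b) ∷ (others ++ ms) ++ (c , suc e) ∷ [])
  lift-path = cong (u ∷_) (trans (cong (_++ d ∷ []) path) (fromMountains-∷ʳ-d ((a , b) ∷ others ++ ms) c e))

split-at-return : ∀ j h v → dyckFrom (j ℕ.+ suc h) v ≡ true →
  Σ (List Step) λ p → Σ (List Step) λ q →
    (v ≡ p ++ d ∷ q) × (dyckFrom j p ≡ true) × (dyckFrom h q ≡ true)
split-at-return j       h []      isPath rewrite ℕP.+-suc j h with () ← isPath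
split-at-return j       h (u ∷ v) isPath with p , q , refl , p-path , q-path ← split-at-return (suc j) h v isPath =
  u ∷ p , q , refl , p-path , q-path
split-at-return zero    h (d ∷ v) isPath = [] , v , refl , refl , isPath
split-at-return (suc j) h (d ∷ v) isPath with p , q , refl , p-path , q-path ← split-at-return j h v isPath =
  d ∷ p , q , refl , p-path , q-path

shapes : ∀ p → dyckFrom 0 p ≡ true → PrimeShape p × TailShape p
shapes p = bounded (length p) p ℕP.≤-refl
  where
  bounded : ∀ n p → length p ≤ n → dyckFrom 0 p ≡ true → PrimeShape p × TailShape p
  bounded n       []      _         _ = pyramidal 0 refl , empty refl
  bounded n       (d ∷ p) _         ()
  bounded zero    (u ∷ p) ()        _
  bounded (suc n) (u ∷ v) (s≤s ∣v∣≤n) isPath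
    with p , q , refl , p-path , q-path ← split-at-return 0 0 v isPath =
    shapes-first-return p q
      (proj₁ (bounded n p (ℕP.≤-trans (LP.length-++-≤ˡ p) ∣v∣≤n) p-path))
      (proj₂ (bounded n q (ℕP.≤-trans (ℕP.≤-trans (ℕP.n≤1+n _) (LP.length-++-≤ʳ (d ∷ q) {p})) ∣v∣≤n) q-path))

-- Weights

count-++ : ∀ (P : ℕ × ℕ → Bool) xs ys → count P (xs ++ ys) ≡ count P xs ℕ.+ count P ys
count-++ P []       ys = refl
count-++ P (x ∷ xs) ys with P x
... | true  = cong suc (count-++ P xs ys)
... | false = count-++ P xs ys

sumW-++ : ∀ (P : ℕ × ℕ → Bool) xs ys → sumW P (xs ++ ys) ≡ sumW P xs ℕ.+ sumW P ys
sumW-++ P []       ys = refl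
sumW-++ P (x ∷ xs) ys with P x
... | true  = trans (cong (weight x ℕ.+_) (sumW-++ P xs ys)) (sym (ℕP.+-assoc (weight x) _ _))
... | false = sumW-++ P xs ys

≡ᵇ-refl : ∀ n → (n ≡ᵇ n) ≡ true
≡ᵇ-refl zero    = refl
≡ᵇ-refl (suc n) = ≡ᵇ-refl n

≢⇒≡ᵇ-false : ∀ m n → m ≢ n → (m ≡ᵇ n) ≡ false
≢⇒≡ᵇ-false m n m≢n with m ≡ᵇ n in eq
... | false = refl
... | true  = ⊥-elim (m≢n (ℕP.≡ᵇ⇒≡ m n (subst T (sym eq) tt)))

sameWord : List Step → List Step → Bool
sameWord []      []       = true
sameWord (u ∷ v) (u ∷ v′) = sameWord v v′
sameWord (d ∷ v) (d ∷ v′) = sameWord v v′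
sameWord _       _        = false

sameWord-refl : ∀ v → sameWord v v ≡ true
sameWord-refl []      = refl
sameWord-refl (u ∷ v) = sameWord-refl v
sameWord-refl (d ∷ v) = sameWord-refl v

sameWord-sound : ∀ v v′ → sameWord v v′ ≡ true → v ≡ v′
sameWord-sound []      []       _    = refl
sameWord-sound (u ∷ v) (u ∷ v′) same = cong (u ∷_) (sameWord-sound v v′ same)
sameWord-sound (d ∷ v) (d ∷ v′) same = cong (d ∷_) (sameWord-sound v v′ same)
sameWord-sound []      (u ∷ _)  ()
sameWord-sound []      (d ∷ _)  ()
sameWord-sound (u ∷ _) []       ()
sameWord-sound (u ∷ _) (d ∷ _)  ()
sameWord-sound (d ∷ _) []       ()
sameWord-sound (d ∷ _) (u ∷ _)  ()

atPyramid : ℕ → List Step → ℤ → ℤ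
atPyramid k p c = if sameWord p (pyramid k) then c else + 0

length-pyramid : ∀ k → length (pyramid k) ≡ double k
length-pyramid zero    = refl
length-pyramid (suc k) = cong suc (begin
  length (up k ++ d ∷ down k)              ≡⟨ LP.length-++ (up k) ⟩
  length (up k) ℕ.+ suc (length (down k))  ≡⟨ cong₂ (λ i j → i ℕ.+ suc j) (LP.length-replicate k)
                                                                        (LP.length-replicate k) ⟩
  k ℕ.+ suc k                              ≡⟨ ℕP.+-suc k k ⟩
  suc (k ℕ.+ k)                            ≡⟨ cong suc (sym (double≡+ k)) ⟩
  suc (double k)                           ∎)
  where open ≡-Reasoning

pyramid-injective : ∀ k k′ → length (pyramid k) ≡ double k′ → k ≡ k′
pyramid-injective k k′ eq = double-injective k k′ (trans (sym (length-pyramid k)) eq)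
  where
  double-injective : ∀ k k′ → double k ≡ double k′ → k ≡ k′
  double-injective zero    zero     _  = refl
  double-injective (suc k) (suc k′) eq = cong suc (double-injective k k′ (ℕP.suc-injective (ℕP.suc-injective eq)))

-- A pyramid has one peak, a skewed lift at least two.
skewed-not-pyramid : ∀ k {p} a b ms c e → lift p ≡ fromMountains ((a , b) ∷ ms ++ (c , e) ∷ []) →
  sameWord p (pyramid k) ≡ false
skewed-not-pyramid k {p} a b ms c e eq with sameWord p (pyramid k) in same
... | false = refl
... | true  = ⊥-elim (one≢two-or-more (begin
  1                                                      ≡⟨ sym (number-of-peaks ((k , k) ∷ [])) ⟩
  length (peaks (fromMountains ((k , k) ∷ [])))          ≡⟨ cong (length ∘ peaks) lift-pyramid≡ ⟩
  length (peaks (fromMountains ((a , b) ∷ ms ++ (c , e) ∷ []))) ≡⟨ number-of-peaks ((a , b) ∷ ms ++ (c , e) ∷ []) ⟩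
  suc (length (ms ++ (c , e) ∷ []))                      ≡⟨ cong suc (LP.length-++ ms) ⟩
  suc (length ms ℕ.+ 1)                                  ∎))
  where
  open ≡-Reasoning
  number-of-peaks : ∀ ms → length (peaks (fromMountains ms)) ≡ length ms
  number-of-peaks ms = trans (cong length (peaks-fromMountains ms)) (LP.length-map _ ms)
  lift-pyramid≡ : fromMountains ((k , k) ∷ []) ≡ fromMountains ((a , b) ∷ ms ++ (c , e) ∷ [])
  lift-pyramid≡ = trans (sym (lift-pyramid-mountain k))
                        (trans (cong lift (sym (sameWord-sound p (pyramid k) same))) eq)
  one≢two-or-more : 1 ≢ suc (length ms ℕ.+ 1)
  one≢two-or-more eq = ℕP.0≢1+n (trans (ℕP.suc-injective eq) (ℕP.+-comm (length ms) 1))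

∑from-single : ∀ m h v c → length v ≡ m → dyckFrom h v ≡ true →
  ∑from h m (λ x → if sameWord x v then c else + 0) ≡ c
∑from-single zero    h       []      c _ path rewrite path = ℤP.+-identityʳ c
∑from-single (suc m) zero    (u ∷ v) c ∣v∣ path =
  trans (∑from-ground m _) (∑from-single m 1 v c (ℕP.suc-injective ∣v∣) path)
∑from-single (suc m) (suc h) (u ∷ v) c ∣v∣ path = begin
  ∑from (suc h) (suc m) (λ x → if sameWord x (u ∷ v) then c else + 0)  ≡⟨ ∑from-suc h m _ ⟩
  ∑from (suc (suc h)) m (λ x → if sameWord x v then c else + 0) + ∑from h m (λ _ → + 0)
    ≡⟨ cong₂ _+_ (∑from-single m (suc (suc h)) v c (ℕP.suc-injective ∣v∣) path) (∑from-zero h m (λ _ → refl)) ⟩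
  c + + 0                                                               ≡⟨ ℤP.+-identityʳ c ⟩
  c                                                                     ∎
  where open ≡-Reasoning
∑from-single (suc m) (suc h) (d ∷ v) c ∣v∣ path = begin
  ∑from (suc h) (suc m) (λ x → if sameWord x (d ∷ v) then c else + 0)  ≡⟨ ∑from-suc h m _ ⟩
  ∑from (suc (suc h)) m (λ _ → + 0) + ∑from h m (λ x → if sameWord x v then c else + 0)
    ≡⟨ cong₂ _+_ (∑from-zero (suc (suc h)) m (λ _ → refl)) (∑from-single m h v c (ℕP.suc-injective ∣v∣) path) ⟩
  + 0 + c                                                               ≡⟨ ℤP.+-identityˡ c ⟩
  c                                                                     ∎
  where open ≡-Reasoning

∑paths-atPyramid : ∀ k c → ∑paths k (λ p → atPyramid k p c) ≡ c
∑paths-atPyramid k c = ∑from-single (double k) 0 (pyramid k) c (length-pyramid k) pyramid-path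
  where
  climb : ∀ k h v → dyckFrom h (up k ++ v) ≡ dyckFrom (k ℕ.+ h) v
  climb zero    h v = refl
  climb (suc k) h v = trans (climb k (suc h) v) (cong (λ h′ → dyckFrom h′ v) (ℕP.+-suc k h))
  fall : ∀ k h v → dyckFrom (k ℕ.+ h) (down k ++ v) ≡ dyckFrom h v
  fall zero    h v = refl
  fall (suc k) h v = fall k h v
  pyramid-path : dyckFrom 0 (pyramid k) ≡ true
  pyramid-path = trans (climb k 0 (down k))
    (trans (cong (dyckFrom (k ℕ.+ 0)) (sym (LP.++-identityʳ (down k)))) (fall k 0 []))

∑paths-null : ∀ j c → ∑paths j (λ q → if null q then c else + 0) ≡ (if j ≡ᵇ 0 then c else + 0)
∑paths-null zero    c = ℤP.+-identityʳ c
∑paths-null (suc j) c = trans (∑from-ground (suc (double j)) _) (∑from-zero 1 (suc (double j)) (λ _ → refl))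

module WeightedPaths (t r w y : ℤ) where

  private
    a≡b+[a-b] : ∀ a b → a ≡ b + (a - b)
    a≡b+[a-b] = solve-∀

    a≡b+c⇒a-b≡c : ∀ {a b c} → a ≡ b + c → a - b ≡ c
    a≡b+c⇒a-b≡c {b = b} {c} refl = ring b c
      where
      ring : ∀ b c → b + c - b ≡ c
      ring = solve-∀

  peaksWeight : List (ℕ × ℕ) → ℤ
  peaksWeight ps = t ^ count isSym ps * r ^ count (not ∘ isSym) ps
                 * w ^ sumW isSym ps * y ^ sumW (not ∘ isSym) ps

  pathWeight : List Step → ℤ
  pathWeight P = peaksWeight (peaks P)

  peaksWeight-++ : ∀ xs ys → peaksWeight (xs ++ ys) ≡ peaksWeight xs * peaksWeight ys
  peaksWeight-++ xs ys
    rewrite count-++ isSym xs ys | count-++ (not ∘ isSym) xs ys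
          | sumW-++ isSym xs ys | sumW-++ (not ∘ isSym) xs ys
          | ℤP.^-distribˡ-+-* t (count isSym xs) (count isSym ys)
          | ℤP.^-distribˡ-+-* r (count (not ∘ isSym) xs) (count (not ∘ isSym) ys)
          | ℤP.^-distribˡ-+-* w (sumW isSym xs) (sumW isSym ys)
          | ℤP.^-distribˡ-+-* y (sumW (not ∘ isSym) xs) (sumW (not ∘ isSym) ys)
    = ring (t ^ count isSym xs) (t ^ count isSym ys)
           (r ^ count (not ∘ isSym) xs) (r ^ count (not ∘ isSym) ys)
           (w ^ sumW isSym xs) (w ^ sumW isSym ys)
           (y ^ sumW (not ∘ isSym) xs) (y ^ sumW (not ∘ isSym) ys)
    where
    ring : ∀ a a′ b b′ c c′ e e′ →
      a * a′ * (b * b′) * (c * c′) * (e * e′) ≡ a * b * c * e * (a′ * b′ * c′ * e′)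
    ring = solve-∀

  peaksWeight-mountain : ∀ i j →
    peaksWeight ((i , j) ∷ []) ≡ (if i ≡ᵇ j then t * w ^ (i ⊓ j) else r * y ^ (i ⊓ j))
  peaksWeight-mountain i j with i ≡ᵇ j
  ... | true  rewrite ℕP.+-identityʳ (i ⊓ j) = ring t (w ^ (i ⊓ j))
    where
    ring : ∀ a b → a * + 1 * + 1 * b * + 1 ≡ a * b
    ring = solve-∀
  ... | false rewrite ℕP.+-identityʳ (i ⊓ j) = ring r (y ^ (i ⊓ j))
    where
    ring : ∀ a b → + 1 * (a * + 1) * + 1 * b ≡ a * b
    ring = solve-∀

  peaksWeight-mountain-cong : ∀ i j i′ j′ → (i ≡ᵇ j) ≡ (i′ ≡ᵇ j′) → i ⊓ j ≡ i′ ⊓ j′ →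
    peaksWeight ((i , j) ∷ []) ≡ peaksWeight ((i′ , j′) ∷ [])
  peaksWeight-mountain-cong i j i′ j′ sym≡ ⊓≡
    rewrite peaksWeight-mountain i j | peaksWeight-mountain i′ j′ | sym≡ | ⊓≡ = refl

  pathWeight-fromMountains : ∀ ms → pathWeight (fromMountains ms) ≡ peaksWeight (map (Product.map suc suc) ms)
  pathWeight-fromMountains ms = cong peaksWeight (peaks-fromMountains ms)

  pathWeight-fromMountains-++ : ∀ X Y →
    pathWeight (fromMountains (X ++ Y)) ≡ pathWeight (fromMountains X) * pathWeight (fromMountains Y)
  pathWeight-fromMountains-++ X Y = begin
    pathWeight (fromMountains (X ++ Y))
      ≡⟨ pathWeight-fromMountains (X ++ Y) ⟩
    peaksWeight (map (Product.map suc suc) (X ++ Y))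
      ≡⟨ cong peaksWeight (LP.map-++ (Product.map suc suc) X Y) ⟩
    peaksWeight (map (Product.map suc suc) X ++ map (Product.map suc suc) Y)
      ≡⟨ peaksWeight-++ (map (Product.map suc suc) X) _ ⟩
    peaksWeight (map (Product.map suc suc) X) * peaksWeight (map (Product.map suc suc) Y)
      ≡⟨ sym (cong₂ _*_ (pathWeight-fromMountains X) (pathWeight-fromMountains Y)) ⟩
    pathWeight (fromMountains X) * pathWeight (fromMountains Y) ∎
    where open ≡-Reasoning

  pathWeight-symmetric : ∀ k → pathWeight (fromMountains ((k , k) ∷ [])) ≡ t * w ^ suc k
  pathWeight-symmetric k = trans (pathWeight-fromMountains ((k , k) ∷ [])) mountain
    where
    mountain : peaksWeight ((suc k , suc k) ∷ []) ≡ t * w ^ suc k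
    mountain rewrite peaksWeight-mountain (suc k) (suc k) | ≡ᵇ-refl k | ℕP.⊓-idem k = refl

  pathWeight-steep-ascent : ∀ k → pathWeight (fromMountains ((suc k , k) ∷ [])) ≡ r * y ^ suc k
  pathWeight-steep-ascent k = trans (pathWeight-fromMountains ((suc k , k) ∷ [])) mountain
    where
    mountain : peaksWeight ((suc (suc k) , suc k) ∷ []) ≡ r * y ^ suc k
    mountain rewrite peaksWeight-mountain (suc (suc k)) (suc k) | ≢⇒≡ᵇ-false (suc k) k ℕP.1+n≢n
                   | ℕP.m≥n⇒m⊓n≡n (ℕP.n≤1+n k) = refl

  pathWeight-steep-descent : ∀ k → pathWeight (fromMountains ((k , suc k) ∷ [])) ≡ r * y ^ suc k
  pathWeight-steep-descent k = trans (pathWeight-fromMountains ((k , suc k) ∷ [])) mountain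
    where
    mountain : peaksWeight ((suc k , suc (suc k)) ∷ []) ≡ r * y ^ suc k
    mountain rewrite peaksWeight-mountain (suc k) (suc (suc k)) | ≢⇒≡ᵇ-false k (suc k) (ℕP.1+n≢n ∘ sym)
                   | ℕP.m≤n⇒m⊓n≡m (ℕP.n≤1+n k) = refl

  private
    mountain-cong : ∀ i j i′ j′ → (i ≡ᵇ j) ≡ (i′ ≡ᵇ j′) → i ⊓ j ≡ i′ ⊓ j′ →
      pathWeight (fromMountains ((i , j) ∷ [])) ≡ pathWeight (fromMountains ((i′ , j′) ∷ []))
    mountain-cong i j i′ j′ sym≡ ⊓≡ = begin
      pathWeight (fromMountains ((i , j) ∷ []))        ≡⟨ pathWeight-fromMountains ((i , j) ∷ []) ⟩
      peaksWeight ((suc i , suc j) ∷ [])               ≡⟨ peaksWeight-mountain-cong _ _ _ _ sym≡ (cong suc ⊓≡) ⟩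
      peaksWeight ((suc i′ , suc j′) ∷ [])             ≡⟨ sym (pathWeight-fromMountains ((i′ , j′) ∷ [])) ⟩
      pathWeight (fromMountains ((i′ , j′) ∷ []))      ∎
      where open ≡-Reasoning

  pathWeight-extend-first : ∀ a b R → b < a →
    pathWeight (fromMountains ((suc a , b) ∷ R)) ≡ pathWeight (fromMountains ((a , b) ∷ R))
  pathWeight-extend-first a b R b<a = begin
    pathWeight (fromMountains ((suc a , b) ∷ R))
      ≡⟨ pathWeight-fromMountains-++ ((suc a , b) ∷ []) R ⟩
    pathWeight (fromMountains ((suc a , b) ∷ [])) * pathWeight (fromMountains R)
      ≡⟨ cong (_* pathWeight (fromMountains R)) (mountain-cong _ _ _ _
           (trans (≢⇒≡ᵇ-false (suc a) b (ℕP.<⇒≢ (ℕP.m<n⇒m<1+n b<a) ∘ sym))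
                  (sym (≢⇒≡ᵇ-false a b (ℕP.<⇒≢ b<a ∘ sym))))
           (trans (ℕP.m≥n⇒m⊓n≡n (ℕP.≤-trans (ℕP.<⇒≤ b<a) (ℕP.n≤1+n a)))
                  (sym (ℕP.m≥n⇒m⊓n≡n (ℕP.<⇒≤ b<a))))) ⟩
    pathWeight (fromMountains ((a , b) ∷ [])) * pathWeight (fromMountains R)
      ≡⟨ sym (pathWeight-fromMountains-++ ((a , b) ∷ []) R) ⟩
    pathWeight (fromMountains ((a , b) ∷ R)) ∎
    where open ≡-Reasoning

  pathWeight-extend-last : ∀ X c e → c < e →
    pathWeight (fromMountains (X ++ (c , e) ∷ []) ++ d ∷ []) ≡ pathWeight (fromMountains (X ++ (c , e) ∷ []))
  pathWeight-extend-last X c e c<e = begin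
    pathWeight (fromMountains (X ++ (c , e) ∷ []) ++ d ∷ [])
      ≡⟨ cong pathWeight (fromMountains-∷ʳ-d X c e) ⟩
    pathWeight (fromMountains (X ++ (c , suc e) ∷ []))
      ≡⟨ pathWeight-fromMountains-++ X ((c , suc e) ∷ []) ⟩
    pathWeight (fromMountains X) * pathWeight (fromMountains ((c , suc e) ∷ []))
      ≡⟨ cong (pathWeight (fromMountains X) *_) (mountain-cong _ _ _ _
           (trans (≢⇒≡ᵇ-false c (suc e) (ℕP.<⇒≢ (ℕP.m<n⇒m<1+n c<e)))
                  (sym (≢⇒≡ᵇ-false c e (ℕP.<⇒≢ c<e))))
           (trans (ℕP.m≤n⇒m⊓n≡m (ℕP.≤-trans (ℕP.<⇒≤ c<e) (ℕP.n≤1+n e)))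
                  (sym (ℕP.m≤n⇒m⊓n≡m (ℕP.<⇒≤ c<e))))) ⟩
    pathWeight (fromMountains X) * pathWeight (fromMountains ((c , e) ∷ []))
      ≡⟨ sym (pathWeight-fromMountains-++ X ((c , e) ∷ [])) ⟩
    pathWeight (fromMountains (X ++ (c , e) ∷ [])) ∎
    where open ≡-Reasoning

  pathWeight-lift-pyramid : ∀ k → pathWeight (lift (pyramid k)) ≡ t * w ^ suc k
  pathWeight-lift-pyramid k = trans (cong pathWeight (lift-pyramid-mountain k)) (pathWeight-symmetric k)

  pathWeight-first-return : ∀ p q → PrimeShape p → TailShape q →
    pathWeight (u ∷ p ++ d ∷ q) ≡ pathWeight (lift p) * pathWeight q
  pathWeight-first-return p q _ (empty refl) = sym (ℤP.*-identityʳ _)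
  pathWeight-first-return p q shape (steepEnd ms c e refl _)
    with firstMountain a b others eq _ ← firstMountainOf shape = begin
    pathWeight (u ∷ p ++ d ∷ fromMountains Y)
      ≡⟨ cong (pathWeight ∘ (u ∷_)) (sym (LP.++-assoc p (d ∷ []) (fromMountains Y))) ⟩
    pathWeight (lift p ++ fromMountains Y)
      ≡⟨ cong (λ v → pathWeight (v ++ fromMountains Y)) eq ⟩
    pathWeight (fromMountains X ++ fromMountains Y)
      ≡⟨ cong pathWeight (sym (fromMountains-++ X Y)) ⟩
    pathWeight (fromMountains (X ++ Y))
      ≡⟨ pathWeight-fromMountains-++ X Y ⟩
    pathWeight (fromMountains X) * pathWeight (fromMountains Y)
      ≡⟨ cong (λ v → pathWeight v * pathWeight (fromMountains Y)) (sym eq) ⟩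
    pathWeight (lift p) * pathWeight (fromMountains Y) ∎
    where
    open ≡-Reasoning
    X Y : List (ℕ × ℕ)
    X = (a , b) ∷ others
    Y = ms ++ (c , e) ∷ []

  -- Appending d to a nonempty q lengthens only the last descent of q.
  pathWeight-++-∷ʳ-d : ∀ {v} X q → v ≡ fromMountains X → TailShape q →
    pathWeight (v ++ q ++ d ∷ [])
      ≡ pathWeight v * pathWeight (q ++ d ∷ [])
        + (if null q then pathWeight (v ++ d ∷ []) - pathWeight v else + 0)
  pathWeight-++-∷ʳ-d {v} X q _ (empty refl) = ring (pathWeight (v ++ d ∷ [])) (pathWeight v)
    where
    ring : ∀ a b → a ≡ b * + 1 + (a - b)
    ring = solve-∀
  pathWeight-++-∷ʳ-d X q refl (steepEnd ms c e refl _) rewrite null-fromMountains-∷ʳ ms (c , e) = begin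
    pathWeight (fromMountains X ++ fromMountains Y ++ d ∷ [])
      ≡⟨ cong (λ v → pathWeight (fromMountains X ++ v)) (fromMountains-∷ʳ-d ms c e) ⟩
    pathWeight (fromMountains X ++ fromMountains Y′)
      ≡⟨ cong pathWeight (sym (fromMountains-++ X Y′)) ⟩
    pathWeight (fromMountains (X ++ Y′))
      ≡⟨ pathWeight-fromMountains-++ X Y′ ⟩
    pathWeight (fromMountains X) * pathWeight (fromMountains Y′)
      ≡⟨ cong (λ v → pathWeight (fromMountains X) * pathWeight v) (sym (fromMountains-∷ʳ-d ms c e)) ⟩
    pathWeight (fromMountains X) * pathWeight (fromMountains Y ++ d ∷ [])
      ≡⟨ sym (ℤP.+-identityʳ _) ⟩
    pathWeight (fromMountains X) * pathWeight (fromMountains Y ++ d ∷ []) + + 0 ∎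
    where
    open ≡-Reasoning
    Y Y′ : List (ℕ × ℕ)
    Y  = ms ++ (c , e) ∷ []
    Y′ = ms ++ (c , suc e) ∷ []

  pathWeight-prepend-u : ∀ k p → PrimeShape p → length p ≡ double k →
    pathWeight (u ∷ lift p) ≡ pathWeight (lift p) + atPyramid k p (r * y ^ suc k - t * w ^ suc k)
  pathWeight-prepend-u k p (pyramidal k′ refl) ∣p∣ with refl ← pyramid-injective k′ k ∣p∣
    rewrite sameWord-refl (pyramid k) = begin
    pathWeight (u ∷ lift (pyramid k))
      ≡⟨ cong (pathWeight ∘ (u ∷_)) (lift-pyramid-mountain k) ⟩
    pathWeight (fromMountains ((suc k , k) ∷ []))
      ≡⟨ pathWeight-steep-ascent k ⟩
    r * y ^ suc k
      ≡⟨ a≡b+[a-b] (r * y ^ suc k) (t * w ^ suc k) ⟩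
    t * w ^ suc k + (r * y ^ suc k - t * w ^ suc k)
      ≡⟨ cong (_+ (r * y ^ suc k - t * w ^ suc k)) (sym (pathWeight-lift-pyramid k)) ⟩
    pathWeight (lift (pyramid k)) + (r * y ^ suc k - t * w ^ suc k) ∎
    where open ≡-Reasoning
  pathWeight-prepend-u k p (skewed a b ms c e eq b<a _) _ rewrite skewed-not-pyramid k a b ms c e eq = begin
    pathWeight (u ∷ lift p)                                  ≡⟨ cong (pathWeight ∘ (u ∷_)) eq ⟩
    pathWeight (fromMountains ((suc a , b) ∷ ms ++ (c , e) ∷ [])) ≡⟨ pathWeight-extend-first a b (ms ++ (c , e) ∷ []) b<a ⟩
    pathWeight (fromMountains ((a , b) ∷ ms ++ (c , e) ∷ []))     ≡⟨ cong pathWeight (sym eq) ⟩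
    pathWeight (lift p)                                      ≡⟨ sym (ℤP.+-identityʳ _) ⟩
    pathWeight (lift p) + + 0                                ∎
    where open ≡-Reasoning

  pathWeight-append-d : ∀ k p → PrimeShape p → length p ≡ double k →
    pathWeight (lift p ++ d ∷ []) ≡ pathWeight (lift p) + atPyramid k p (r * y ^ suc k - t * w ^ suc k)
  pathWeight-append-d k p (pyramidal k′ refl) ∣p∣ with refl ← pyramid-injective k′ k ∣p∣
    rewrite sameWord-refl (pyramid k) = begin
    pathWeight (lift (pyramid k) ++ d ∷ [])
      ≡⟨ cong (λ v → pathWeight (v ++ d ∷ [])) (lift-pyramid-mountain k) ⟩
    pathWeight (fromMountains ((k , k) ∷ []) ++ d ∷ [])
      ≡⟨ cong pathWeight (fromMountains-∷ʳ-d [] k k) ⟩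
    pathWeight (fromMountains ((k , suc k) ∷ []))
      ≡⟨ pathWeight-steep-descent k ⟩
    r * y ^ suc k
      ≡⟨ a≡b+[a-b] (r * y ^ suc k) (t * w ^ suc k) ⟩
    t * w ^ suc k + (r * y ^ suc k - t * w ^ suc k)
      ≡⟨ cong (_+ (r * y ^ suc k - t * w ^ suc k)) (sym (pathWeight-lift-pyramid k)) ⟩
    pathWeight (lift (pyramid k)) + (r * y ^ suc k - t * w ^ suc k) ∎
    where open ≡-Reasoning
  pathWeight-append-d k p (skewed a b ms c e eq _ c<e) _ rewrite skewed-not-pyramid k a b ms c e eq = begin
    pathWeight (lift p ++ d ∷ [])                                       ≡⟨ cong (λ v → pathWeight (v ++ d ∷ [])) eq ⟩
    pathWeight (fromMountains (((a , b) ∷ ms) ++ (c , e) ∷ []) ++ d ∷ []) ≡⟨ pathWeight-extend-last ((a , b) ∷ ms) c e c<e ⟩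
    pathWeight (fromMountains ((a , b) ∷ ms ++ (c , e) ∷ []))           ≡⟨ cong pathWeight (sym eq) ⟩
    pathWeight (lift p)                                                 ≡⟨ sym (ℤP.+-identityʳ _) ⟩
    pathWeight (lift p) + + 0                                           ∎
    where open ≡-Reasoning

  pathWeight-prepend-u-append-d : ∀ k p → PrimeShape p → length p ≡ double k →
    pathWeight (u ∷ lift p ++ d ∷ [])
      ≡ pathWeight (u ∷ lift p) + atPyramid k p (t * w ^ suc (suc k) - r * y ^ suc k)
  pathWeight-prepend-u-append-d k p (pyramidal k′ refl) ∣p∣ with refl ← pyramid-injective k′ k ∣p∣
    rewrite sameWord-refl (pyramid k) = begin
    pathWeight (u ∷ lift (pyramid k) ++ d ∷ [])
      ≡⟨ cong (λ v → pathWeight (u ∷ v ++ d ∷ [])) (lift-pyramid-mountain k) ⟩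
    pathWeight (u ∷ fromMountains ((k , k) ∷ []) ++ d ∷ [])
      ≡⟨ cong (pathWeight ∘ (u ∷_)) (fromMountains-∷ʳ-d [] k k) ⟩
    pathWeight (fromMountains ((suc k , suc k) ∷ []))
      ≡⟨ pathWeight-symmetric (suc k) ⟩
    t * w ^ suc (suc k)
      ≡⟨ a≡b+[a-b] (t * w ^ suc (suc k)) (r * y ^ suc k) ⟩
    r * y ^ suc k + (t * w ^ suc (suc k) - r * y ^ suc k)
      ≡⟨ cong (_+ (t * w ^ suc (suc k) - r * y ^ suc k)) (sym (trans
           (cong (pathWeight ∘ (u ∷_)) (lift-pyramid-mountain k)) (pathWeight-steep-ascent k))) ⟩
    pathWeight (u ∷ lift (pyramid k)) + (t * w ^ suc (suc k) - r * y ^ suc k) ∎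
    where open ≡-Reasoning
  pathWeight-prepend-u-append-d k p (skewed a b ms c e eq _ c<e) _ rewrite skewed-not-pyramid k a b ms c e eq = begin
    pathWeight (u ∷ lift p ++ d ∷ [])
      ≡⟨ cong (λ v → pathWeight (u ∷ v ++ d ∷ [])) eq ⟩
    pathWeight (fromMountains (((suc a , b) ∷ ms) ++ (c , e) ∷ []) ++ d ∷ [])
      ≡⟨ pathWeight-extend-last ((suc a , b) ∷ ms) c e c<e ⟩
    pathWeight (fromMountains ((suc a , b) ∷ ms ++ (c , e) ∷ []))
      ≡⟨ cong (pathWeight ∘ (u ∷_)) (sym eq) ⟩
    pathWeight (u ∷ lift p)
      ≡⟨ sym (ℤP.+-identityʳ _) ⟩
    pathWeight (u ∷ lift p) + + 0 ∎
    where open ≡-Reasoning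

  pathSeries extendedSeries primeSeries aSeries bSeries : Series
  pathSeries n     = ∑paths n pathWeight
  extendedSeries n = ∑paths n (λ q → pathWeight (q ++ d ∷ []))
  primeSeries zero    = + 0
  primeSeries (suc n) = ∑paths n (pathWeight ∘ lift)
  aSeries zero    = + 0
  aSeries (suc n) = t * w ^ suc n
  bSeries zero    = + 0
  bSeries (suc n) = r * y ^ suc n

  ∑paths-decompose : ∀ i j (α β : List Step → ℤ) (g : List Step → ℤ) →
    ∑paths i (λ p → ∑paths j (λ q → α p * g q + (if null q then β p else + 0)))
      ≡ ∑paths i α * ∑paths j g + (if j ≡ᵇ 0 then ∑paths i β else + 0)
  ∑paths-decompose i j α β g = begin
    ∑paths i (λ p → ∑paths j (λ q → α p * g q + (if null q then β p else + 0)))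
      ≡⟨ ∑from-cong 0 (double i) (λ p _ _ → trans (∑from-+ 0 (double j) _ _)
           (cong₂ _+_ (∑from-*ˡ 0 (double j) (α p) g) (∑paths-null j (β p)))) ⟩
    ∑paths i (λ p → α p * ∑paths j g + (if j ≡ᵇ 0 then β p else + 0))
      ≡⟨ ∑from-+ 0 (double i) _ _ ⟩
    ∑paths i (λ p → α p * ∑paths j g) + ∑paths i (λ p → if j ≡ᵇ 0 then β p else + 0)
      ≡⟨ cong₂ _+_ (∑from-*ʳ 0 (double i) (∑paths j g) α) (∑paths-if (j ≡ᵇ 0)) ⟩
    ∑paths i α * ∑paths j g + (if j ≡ᵇ 0 then ∑paths i β else + 0) ∎
    where
    open ≡-Reasoning
    ∑paths-if : ∀ b → ∑paths i (λ p → if b then β p else + 0) ≡ (if b then ∑paths i β else + 0)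
    ∑paths-if true  = refl
    ∑paths-if false = ∑from-zero 0 (double i) (λ _ → refl)

  pathSeries-first-return : pathSeries ≈ one ⊕ primeSeries ⊛ pathSeries
  pathSeries-first-return zero    = refl
  pathSeries-first-return (suc n) = begin
    pathSeries (suc n)
      ≡⟨ ∑paths-first-return n pathWeight ⟩
    Σ< (suc n) (λ i → ∑paths i (λ p → ∑paths (n ∸ i) (λ q → pathWeight (u ∷ p ++ d ∷ q))))
      ≡⟨ Σ<-cong′ (suc n) term ⟩
    Σ< (suc n) (λ i → primeSeries (suc i) * pathSeries (n ∸ i))
      ≡⟨ sym (⊛-suc primeSeries pathSeries n refl) ⟩
    (primeSeries ⊛ pathSeries) (suc n)
      ≡⟨ sym (ℤP.+-identityˡ _) ⟩
    (one ⊕ primeSeries ⊛ pathSeries) (suc n) ∎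
    where
    open ≡-Reasoning
    term : ∀ i → ∑paths i (λ p → ∑paths (n ∸ i) (λ q → pathWeight (u ∷ p ++ d ∷ q)))
               ≡ primeSeries (suc i) * pathSeries (n ∸ i)
    term i = begin
      ∑paths i (λ p → ∑paths (n ∸ i) (λ q → pathWeight (u ∷ p ++ d ∷ q)))
        ≡⟨ ∑from-cong 0 (double i) (λ p _ p-path → ∑from-cong 0 (double (n ∸ i)) (λ q _ q-path →
             pathWeight-first-return p q (proj₁ (shapes p p-path)) (proj₂ (shapes q q-path)))) ⟩
      ∑paths i (λ p → ∑paths (n ∸ i) (λ q → pathWeight (lift p) * pathWeight q))
        ≡⟨ ∑from-cong 0 (double i) (λ p _ _ → ∑from-*ˡ 0 (double (n ∸ i)) (pathWeight (lift p)) pathWeight) ⟩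
      ∑paths i (λ p → pathWeight (lift p) * pathSeries (n ∸ i))
        ≡⟨ ∑from-*ʳ 0 (double i) (pathSeries (n ∸ i)) (pathWeight ∘ lift) ⟩
      primeSeries (suc i) * pathSeries (n ∸ i) ∎

  first-return-∷ʳ-d : ∀ p q → (u ∷ p ++ d ∷ q) ++ d ∷ [] ≡ lift p ++ q ++ d ∷ []
  first-return-∷ʳ-d p q =
    cong (u ∷_) (trans (LP.++-assoc p (d ∷ q) (d ∷ [])) (sym (LP.++-assoc p (d ∷ []) (q ++ d ∷ []))))

  pathWeight-extended-first-return : ∀ i p q → length p ≡ double i →
    dyckFrom 0 p ≡ true → dyckFrom 0 q ≡ true →
    pathWeight ((u ∷ p ++ d ∷ q) ++ d ∷ [])
      ≡ pathWeight (lift p) * pathWeight (q ++ d ∷ [])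
        + (if null q then atPyramid i p (bSeries (suc i) - aSeries (suc i)) else + 0)
  pathWeight-extended-first-return i p q ∣p∣ p-path q-path
    with firstMountain a b others eq _ ← firstMountainOf (proj₁ (shapes p p-path)) = begin
    pathWeight ((u ∷ p ++ d ∷ q) ++ d ∷ [])
      ≡⟨ cong pathWeight (first-return-∷ʳ-d p q) ⟩
    pathWeight (lift p ++ q ++ d ∷ [])
      ≡⟨ pathWeight-++-∷ʳ-d ((a , b) ∷ others) q eq (proj₂ (shapes q q-path)) ⟩
    pathWeight (lift p) * pathWeight (q ++ d ∷ [])
      + (if null q then pathWeight (lift p ++ d ∷ []) - pathWeight (lift p) else + 0)
      ≡⟨ cong (λ δ → pathWeight (lift p) * pathWeight (q ++ d ∷ []) + (if null q then δ else + 0))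
              (a≡b+c⇒a-b≡c (pathWeight-append-d i p (proj₁ (shapes p p-path)) ∣p∣)) ⟩
    pathWeight (lift p) * pathWeight (q ++ d ∷ [])
      + (if null q then atPyramid i p (bSeries (suc i) - aSeries (suc i)) else + 0) ∎
    where open ≡-Reasoning

  ∑paths-extended-first-return : ∀ n i →
    ∑paths i (λ p → ∑paths (n ∸ i) (λ q → pathWeight ((u ∷ p ++ d ∷ q) ++ d ∷ [])))
      ≡ primeSeries (suc i) * extendedSeries (n ∸ i)
        + (if (n ∸ i) ≡ᵇ 0 then bSeries (suc i) - aSeries (suc i) else + 0)
  ∑paths-extended-first-return n i = begin
    ∑paths i (λ p → ∑paths (n ∸ i) (λ q → pathWeight ((u ∷ p ++ d ∷ q) ++ d ∷ [])))
      ≡⟨ ∑from-cong 0 (double i) (λ p ∣p∣ p-path → ∑from-cong 0 (double (n ∸ i)) (λ q _ q-path →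
           pathWeight-extended-first-return i p q ∣p∣ p-path q-path)) ⟩
    _ ≡⟨ ∑paths-decompose i (n ∸ i) (pathWeight ∘ lift) (λ p → atPyramid i p (bSeries (suc i) - aSeries (suc i)))
                            (λ q → pathWeight (q ++ d ∷ [])) ⟩
    primeSeries (suc i) * extendedSeries (n ∸ i)
      + (if (n ∸ i) ≡ᵇ 0 then ∑paths i (λ p → atPyramid i p (bSeries (suc i) - aSeries (suc i))) else + 0)
      ≡⟨ cong (λ δ → primeSeries (suc i) * extendedSeries (n ∸ i) + (if (n ∸ i) ≡ᵇ 0 then δ else + 0))
              (∑paths-atPyramid i _) ⟩
    primeSeries (suc i) * extendedSeries (n ∸ i)
      + (if (n ∸ i) ≡ᵇ 0 then bSeries (suc i) - aSeries (suc i) else + 0) ∎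
    where open ≡-Reasoning

  extendedSeries-first-return : extendedSeries ≈ one ⊖ aSeries ⊕ bSeries ⊕ primeSeries ⊛ extendedSeries
  extendedSeries-first-return zero    = refl
  extendedSeries-first-return (suc n) = begin
    extendedSeries (suc n)
      ≡⟨ ∑paths-first-return n (λ v → pathWeight (v ++ d ∷ [])) ⟩
    Σ< (suc n) (λ i → ∑paths i (λ p → ∑paths (n ∸ i) (λ q → pathWeight ((u ∷ p ++ d ∷ q) ++ d ∷ []))))
      ≡⟨ Σ<-cong′ (suc n) (∑paths-extended-first-return n) ⟩
    Σ< (suc n) (λ i → primeSeries (suc i) * extendedSeries (n ∸ i) + correction i)
      ≡⟨ Σ<-+ (suc n) (λ i → primeSeries (suc i) * extendedSeries (n ∸ i)) correction ⟩
    Σ< (suc n) (λ i → primeSeries (suc i) * extendedSeries (n ∸ i)) + Σ< (suc n) correction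
      ≡⟨ cong₂ _+_ (sym (⊛-suc primeSeries extendedSeries n refl))
                   (Σ<-last n (λ i → bSeries (suc i) - aSeries (suc i))) ⟩
    (primeSeries ⊛ extendedSeries) (suc n) + (bSeries (suc n) - aSeries (suc n))
      ≡⟨ ring _ (aSeries (suc n)) (bSeries (suc n)) ⟩
    (one ⊖ aSeries ⊕ bSeries ⊕ primeSeries ⊛ extendedSeries) (suc n) ∎
    where
    open ≡-Reasoning
    ring : ∀ s a b → s + (b - a) ≡ + 0 - a + b + s
    ring = solve-∀
    correction : ℕ → ℤ
    correction i = if (n ∸ i) ≡ᵇ 0 then bSeries (suc i) - aSeries (suc i) else + 0

  pathWeight-lifted-first-return : ∀ i p q → length p ≡ double i →
    dyckFrom 0 p ≡ true → dyckFrom 0 q ≡ true →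
    pathWeight (lift (u ∷ p ++ d ∷ q))
      ≡ (pathWeight (lift p) + atPyramid i p (bSeries (suc i) - aSeries (suc i))) * pathWeight (q ++ d ∷ [])
        + (if null q then atPyramid i p (aSeries (suc (suc i)) - bSeries (suc i)) else + 0)
  pathWeight-lifted-first-return i p q ∣p∣ p-path q-path
    with firstMountain a b others eq _ ← firstMountainOf (proj₁ (shapes p p-path)) = begin
    pathWeight (lift (u ∷ p ++ d ∷ q))
      ≡⟨ cong (pathWeight ∘ (u ∷_)) (first-return-∷ʳ-d p q) ⟩
    pathWeight ((u ∷ lift p) ++ q ++ d ∷ [])
      ≡⟨ pathWeight-++-∷ʳ-d ((suc a , b) ∷ others) q (cong (u ∷_) eq) (proj₂ (shapes q q-path)) ⟩
    pathWeight (u ∷ lift p) * pathWeight (q ++ d ∷ [])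
      + (if null q then pathWeight (u ∷ lift p ++ d ∷ []) - pathWeight (u ∷ lift p) else + 0)
      ≡⟨ cong₂ (λ α β → α * pathWeight (q ++ d ∷ []) + (if null q then β else + 0))
               (pathWeight-prepend-u i p (proj₁ (shapes p p-path)) ∣p∣)
               (a≡b+c⇒a-b≡c (pathWeight-prepend-u-append-d i p (proj₁ (shapes p p-path)) ∣p∣)) ⟩
    (pathWeight (lift p) + atPyramid i p (bSeries (suc i) - aSeries (suc i))) * pathWeight (q ++ d ∷ [])
      + (if null q then atPyramid i p (aSeries (suc (suc i)) - bSeries (suc i)) else + 0) ∎
    where open ≡-Reasoning

  ∑paths-lifted-first-return : ∀ n i →
    ∑paths i (λ p → ∑paths (n ∸ i) (λ q → pathWeight (lift (u ∷ p ++ d ∷ q))))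
      ≡ (primeSeries ⊖ aSeries ⊕ bSeries) (suc i) * extendedSeries (n ∸ i)
        + (if (n ∸ i) ≡ᵇ 0 then aSeries (suc (suc i)) - bSeries (suc i) else + 0)
  ∑paths-lifted-first-return n i = begin
    ∑paths i (λ p → ∑paths (n ∸ i) (λ q → pathWeight (lift (u ∷ p ++ d ∷ q))))
      ≡⟨ ∑from-cong 0 (double i) (λ p ∣p∣ p-path → ∑from-cong 0 (double (n ∸ i)) (λ q _ q-path →
           pathWeight-lifted-first-return i p q ∣p∣ p-path q-path)) ⟩
    _ ≡⟨ ∑paths-decompose i (n ∸ i) (λ p → pathWeight (lift p) + atPyramid i p (bSeries (suc i) - aSeries (suc i)))
           (λ p → atPyramid i p (aSeries (suc (suc i)) - bSeries (suc i))) (λ q → pathWeight (q ++ d ∷ [])) ⟩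
    ∑paths i (λ p → pathWeight (lift p) + atPyramid i p (bSeries (suc i) - aSeries (suc i))) * extendedSeries (n ∸ i)
      + (if (n ∸ i) ≡ᵇ 0 then ∑paths i (λ p → atPyramid i p (aSeries (suc (suc i)) - bSeries (suc i))) else + 0)
      ≡⟨ cong₂ (λ α β → α * extendedSeries (n ∸ i) + (if (n ∸ i) ≡ᵇ 0 then β else + 0))
               (trans (∑from-+ 0 (double i) (pathWeight ∘ lift) _)
                      (trans (cong (_+_ (primeSeries (suc i))) (∑paths-atPyramid i _))
                             (ring (primeSeries (suc i)) (aSeries (suc i)) (bSeries (suc i)))))
               (∑paths-atPyramid i _) ⟩
    (primeSeries ⊖ aSeries ⊕ bSeries) (suc i) * extendedSeries (n ∸ i)
      + (if (n ∸ i) ≡ᵇ 0 then aSeries (suc (suc i)) - bSeries (suc i) else + 0) ∎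
    where
    open ≡-Reasoning
    ring : ∀ P a b → P + (b - a) ≡ P - a + b
    ring = solve-∀

  primeSeries-suc : ∀ m →
    primeSeries (suc m) ≡ aSeries (suc m) + ((primeSeries ⊖ aSeries ⊕ bSeries) ⊛ extendedSeries) m - bSeries m
  primeSeries-suc zero = trans (ℤP.+-identityʳ _) (trans (pathWeight-lift-pyramid 0) (ring (t * w ^ 1)))
    where
    ring : ∀ a → a ≡ a + + 0 - + 0
    ring = solve-∀
  primeSeries-suc (suc n) = begin
    primeSeries (suc (suc n))
      ≡⟨ ∑paths-first-return n (pathWeight ∘ lift) ⟩
    Σ< (suc n) (λ i → ∑paths i (λ p → ∑paths (n ∸ i) (λ q → pathWeight (lift (u ∷ p ++ d ∷ q)))))
      ≡⟨ Σ<-cong′ (suc n) (∑paths-lifted-first-return n) ⟩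
    Σ< (suc n) (λ i → U (suc i) * extendedSeries (n ∸ i) + correction i)
      ≡⟨ Σ<-+ (suc n) (λ i → U (suc i) * extendedSeries (n ∸ i)) correction ⟩
    Σ< (suc n) (λ i → U (suc i) * extendedSeries (n ∸ i)) + Σ< (suc n) correction
      ≡⟨ cong₂ _+_ (sym (⊛-suc U extendedSeries n refl))
                   (Σ<-last n (λ i → aSeries (suc (suc i)) - bSeries (suc i))) ⟩
    (U ⊛ extendedSeries) (suc n) + (aSeries (suc (suc n)) - bSeries (suc n))
      ≡⟨ ring _ (aSeries (suc (suc n))) (bSeries (suc n)) ⟩
    aSeries (suc (suc n)) + (U ⊛ extendedSeries) (suc n) - bSeries (suc n) ∎
    where
    open ≡-Reasoning
    ring : ∀ s a b → s + (a - b) ≡ a + s - b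
    ring = solve-∀
    U : Series
    U = primeSeries ⊖ aSeries ⊕ bSeries
    correction : ℕ → ℤ
    correction i = if (n ∸ i) ≡ᵇ 0 then aSeries (suc (suc i)) - bSeries (suc i) else + 0

  primeSeries-decomposition :
    primeSeries ≈ aSeries ⊕ Z ⊛ ((primeSeries ⊖ aSeries ⊕ bSeries) ⊛ extendedSeries) ⊖ Z ⊛ bSeries
  primeSeries-decomposition zero    = refl
  primeSeries-decomposition (suc m) = trans (primeSeries-suc m)
    (sym (cong₂ (λ x y → aSeries (suc m) + x - y) (Z-⊛ ((primeSeries ⊖ aSeries ⊕ bSeries) ⊛ extendedSeries) m) (Z-⊛ bSeries m)))

  A≈aSeries : A t r w y ≈ aSeries
  A≈aSeries n = trans (⊛-assoc (const (t * w)) Z (geom w) n) (trans (const-⊛ (t * w) (Z ⊛ geom w) n) (coefficient n))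
    where
    coefficient : ∀ n → t * w * (Z ⊛ geom w) n ≡ aSeries n
    coefficient zero    = ℤP.*-zeroʳ (t * w)
    coefficient (suc n) = trans (cong (t * w *_) (Z-⊛ (geom w) n)) (ℤP.*-assoc t w (w ^ n))

  B≈bSeries : B t r w y ≈ bSeries
  B≈bSeries n = trans (⊛-assoc (const (r * y)) Z (geom y) n) (trans (const-⊛ (r * y) (Z ⊛ geom y) n) (coefficient n))
    where
    coefficient : ∀ n → r * y * (Z ⊛ geom y) n ≡ bSeries n
    coefficient zero    = ℤP.*-zeroʳ (r * y)
    coefficient (suc n) = trans (cong (r * y *_) (Z-⊛ (geom y) n)) (ℤP.*-assoc r y (y ^ n))

  F≈pathSeries : F t r w y ≈ pathSeries
  F≈pathSeries n = trans (sum-filter (words (n ℕ.+ n))) (cong (λ m → ∑from 0 m pathWeight) (sym (double≡+ n)))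
    where
    sum-filter : ∀ vs → sumℤ (map pathWeight (filter (λ v → isDyck v ≟ true) vs))
                      ≡ sumℤ (map (λ v → if dyckFrom 0 v then pathWeight v else + 0) vs)
    sum-filter []       = refl
    sum-filter (v ∷ vs) with dyckFrom 0 v
    ... | true  = cong (_+_ (pathWeight v)) (sum-filter vs)
    ... | false = trans (sum-filter vs) (sym (ℤP.+-identityˡ _))

  F-first-return : F t r w y ≈ one ⊕ primeSeries ⊛ F t r w y
  F-first-return = ≈-trans F≈pathSeries (≈-trans pathSeries-first-return
                     (⊕-cong (≈-refl {one}) (⊛-cong (≈-refl {primeSeries}) (≈-sym F≈pathSeries))))

  extendedSeries-equation : extendedSeries ≈ one ⊖ A t r w y ⊕ B t r w y ⊕ primeSeries ⊛ extendedSeries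
  extendedSeries-equation = ≈-trans extendedSeries-first-return
    (⊕-cong (⊕-cong (⊖-cong (≈-refl {one}) (≈-sym A≈aSeries)) (≈-sym B≈bSeries))
            (≈-refl {primeSeries ⊛ extendedSeries}))

  primeSeries-equation : primeSeries ≈ A t r w y ⊕ Z ⊛ ((primeSeries ⊖ A t r w y ⊕ B t r w y) ⊛ extendedSeries)
                                       ⊖ Z ⊛ B t r w y
  primeSeries-equation = ≈-trans primeSeries-decomposition
    (⊖-cong (⊕-cong (≈-sym A≈aSeries)
                    (⊛-cong (≈-refl {Z}) (⊛-cong (⊕-cong (⊖-cong (≈-refl {primeSeries}) (≈-sym A≈aSeries))
                                                         (≈-sym B≈bSeries))
                                                 (≈-refl {extendedSeries}))))
            (⊛-cong (≈-refl {Z}) (≈-sym B≈bSeries)))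

module Elimination (A B F P G : Series) where

  Y N D R S : Series
  Y = one ⊖ A ⊕ B
  N = one ⊕ Z ⊖ (one ⊕ Z) ⊛ A ⊕ two ⊛ Z ⊛ B
  D = two ⊛ Z ⊛ (Y ⊛ Y)
  R = (one ⊖ Z) ⊛ ((one ⊖ A) ⊛ (one ⊖ A) ⊖ Z ⊛ ((one ⊖ A ⊕ two ⊛ B) ⊛ (one ⊖ A ⊕ two ⊛ B)))
  S = N ⊖ D ⊛ F

  eF eG eP : Series
  eF = F ⊖ (one ⊕ P ⊛ F)
  eG = G ⊖ (Y ⊕ P ⊛ G)
  eP = P ⊖ (A ⊕ Z ⊛ ((P ⊖ A ⊕ B) ⊛ G) ⊖ Z ⊛ B)

  cF cG cP : Series
  cF = K ⊛ (one ⊕ Z ⊛ (const (- + 1) ⊛ (Y ⊛ F ⊖ one) ⊛ G ⊖ (Y ⊛ F ⊕ eG ⊛ F ⊖ eF ⊛ G)))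
    where K = const (- + 4) ⊛ Z ⊛ Y ⊛ Y
  cG = K ⊛ Z ⊛ (Y ⊛ F ⊖ one) ⊛ F
    where K = const (- + 4) ⊛ Z ⊛ Y ⊛ Y
  cP = K ⊛ F
    where K = const (- + 4) ⊛ Z ⊛ Y ⊛ Y

  S²-certificate : S ⊛ S ≈ R ⊕ (eF ⊛ cF ⊕ eG ⊛ cG ⊕ eP ⊛ cP)
  S²-certificate = solve 6 (λ a b f p g z →
    let y   = con (+ 1) :- a :+ b
        n   = con (+ 1) :+ z :- (con (+ 1) :+ z) :* a :+ con (+ 2) :* z :* b
        δ   = con (+ 2) :* z :* (y :* y)
        ρ   = (con (+ 1) :- z) :* ((con (+ 1) :- a) :* (con (+ 1) :- a)
                :- z :* ((con (+ 1) :- a :+ con (+ 2) :* b) :* (con (+ 1) :- a :+ con (+ 2) :* b)))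
        s   = n :- δ :* f
        ef  = f :- (con (+ 1) :+ p :* f)
        eg  = g :- (y :+ p :* g)
        ep  = p :- ((a :+ z :* ((p :- a :+ b) :* g)) :- z :* b)
        k   = con (- + 4) :* z :* y :* y
        cf  = k :* (con (+ 1) :+ z :* (con (- + 1) :* (y :* f :- con (+ 1)) :* g :- (y :* f :+ eg :* f :- ef :* g)))
        cg  = k :* z :* (y :* f :- con (+ 1)) :* f
        cp  = k :* f
    in s :* s := ρ :+ (ef :* cf :+ eg :* cg :+ ep :* cp)) ≈-refl A B F P G Z

  S²≈R : F ≈ one ⊕ P ⊛ F → G ≈ Y ⊕ P ⊛ G → P ≈ A ⊕ Z ⊛ ((P ⊖ A ⊕ B) ⊛ G) ⊖ Z ⊛ B → S ⊛ S ≈ R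
  S²≈R F-eq G-eq P-eq n = begin
    (S ⊛ S) n                                            ≡⟨ S²-certificate n ⟩
    R n + ((eF ⊛ cF) n + (eG ⊛ cG) n + (eP ⊛ cP) n)     ≡⟨ cong₂ (λ a b → R n + (a + b))
                                                              (cong₂ _+_ (vanishes F-eq cF) (vanishes G-eq cG))
                                                              (vanishes P-eq cP) ⟩
    R n + (+ 0 + + 0 + + 0)                              ≡⟨ ℤP.+-identityʳ (R n) ⟩
    R n                                                  ∎
    where
    open ≡-Reasoning
    vanishes : ∀ {f g} → f ≈ g → ∀ c → ((f ⊖ g) ⊛ c) n ≡ + 0
    vanishes {f} {g} f≈g c = trans (⊛-cong f⊖g≈0 (≈-refl {c}) n) (⊛-zeroˡ c n)
      where
      f⊖g≈0 : f ⊖ g ≈ 0ₛ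
      f⊖g≈0 m = trans (cong (_- g m) (f≈g m)) (ℤP.+-inverseʳ (g m))

  S₀≡1 : A 0 ≡ + 0 → S 0 ≡ + 1
  S₀≡1 A₀≡0 rewrite A₀≡0 = refl

  D⊛F≈N⊖S : D ⊛ F ≈ N ⊖ S
  D⊛F≈N⊖S n = sym (ring (N n) ((D ⊛ F) n))
    where
    ring : ∀ a b → a - (a - b) ≡ b
    ring = solve-∀

corollary2p5 : (t r w y : ℤ) →
    Σ Series (λ S → (S 0 ≡ + 1) × (S ⊛ S ≈ Rad t r w y)
    × (Den t r w y ⊛ F t r w y ≈ Num t r w y ⊖ S))
corollary2p5 t r w y =
  S , S₀≡1 (A≈aSeries 0) , S²≈R F-first-return extendedSeries-equation primeSeries-equation , D⊛F≈N⊖S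
  where
  open WeightedPaths t r w y
  open Elimination (A t r w y) (B t r w y) (F t r w y) primeSeries extendedSeries
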